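{- Let $\mathscr C\le\mathbb F_q^n$ be a linear intersecting code with minimum Hamming distance $d$, with $n\ge 2d$. Suppose there is no coordinate $j\in[n]$ such that $x_j\neq0$ for every codeword $x\in\mathscr C$ of weight $d$. Then \[ W_d(\mathscr C)\le (q-1)\left(\binom{n-1}{d-1}-\binom{n-d-1}{d-1}+1\right). \]
   Context: For $x\in\mathbb F_q^n$, $\sigma(x)=\{i: x_i\neq0\}$ and $w(x)=|\sigma(x)|$ (the weight). A code $\mathscr C$ is intersecting if $\sigma(v)\cap\sigma(w)\neq\emptyset$ for all nonzero $v,w\in\mathscr C$. For $0\le i\le n$, $W_i(\mathscr C)=|\{x\in\mathscr C: w(x)=i\}|$. -}

module Defs where

open import Level using (Level; _⊔_)
open import Data.Nat using (ℕ; _≤_)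
open import Data.Fin using (Fin)
import Data.Fin.Properties as FinP
open import Data.List using (List; length; filter; allFin)
open import Data.List.Relation.Unary.All using (All)
open import Data.List.Relation.Unary.AllPairs using (AllPairs)
open import Data.Product using (Σ; _×_; _,_)
open import Data.Empty using (⊥)
open import Relation.Nullary using (¬_; Dec; yes; no)
open import Relation.Nullary.Decidable using (¬?)
open import Relation.Binary using (Decidable)
open import Relation.Binary.PropositionalEquality as ≡ using (_≡_)
open import Algebra.Bundles using (CommutativeRing)
open import Function.Bundles using (Inverse)

record Field (c ℓ : Level) : Set (Level.suc (c ⊔ ℓ)) where
  field
    commRing : CommutativeRing c ℓ
  open CommutativeRing commRing public
  field
    1≉0     : ¬ (1# ≈ 0#)
    inverse : ∀ x → ¬ (x ≈ 0#) → Σ Carrier λ y → x * y ≈ 1#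

record FiniteField (c ℓ : Level) (q : ℕ) : Set (Level.suc (c ⊔ ℓ)) where
  field
    field′ : Field c ℓ
  open Field field′ public
  field
    enum : Inverse (≡.setoid (Fin q)) setoid

  _≟_ : Decidable _≈_
  x ≟ y with Inverse.from enum x FinP.≟ Inverse.from enum y
  ... | yes p = yes (trans (sym (Inverse.inverseˡ enum ≡.refl))
                     (trans (Inverse.to-cong enum p) (Inverse.inverseˡ enum ≡.refl)))
  ... | no ¬p = no (λ x≈y → ¬p (Inverse.from-cong enum x≈y))

module _ {c ℓ : Level} {q : ℕ} (F : FiniteField c ℓ q) where
  open FiniteField F

  Word : ℕ → Set c
  Word n = Fin n → Carrier

  zeroW : ∀ {n} → Word n
  zeroW _ = 0#

  _+W_ : ∀ {n} → Word n → Word n → Word n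
  (x +W y) i = x i + y i

  _·W_ : ∀ {n} → Carrier → Word n → Word n
  (a ·W x) i = a * x i

  _≈W_ : ∀ {n} → Word n → Word n → Set ℓ
  x ≈W y = ∀ i → x i ≈ y i

  support : ∀ {n} → Word n → List (Fin n)
  support {n} x = filter (λ i → ¬? (x i ≟ 0#)) (allFin n)

  weight : ∀ {n} → Word n → ℕ
  weight x = length (support x)

  dist : ∀ {n} → Word n → Word n → ℕ
  dist {n} x y = length (filter (λ i → ¬? (x i ≟ y i)) (allFin n))

  Code : ℕ → (p : Level) → Set (c ⊔ Level.suc p)
  Code n p = Word n → Set p

  record IsLinear {n p} (𝒞 : Code n p) : Set (c ⊔ ℓ ⊔ p) where
    field
      resp  : ∀ {x y} → x ≈W y → 𝒞 x → 𝒞 y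
      zero∈ : 𝒞 zeroW
      +∈    : ∀ {x y} → 𝒞 x → 𝒞 y → 𝒞 (x +W y)
      ·∈    : ∀ a {x} → 𝒞 x → 𝒞 (a ·W x)

  NonZero : ∀ {n} → Word n → Set ℓ
  NonZero x = ¬ (∀ i → x i ≈ 0#)

  Intersecting : ∀ {n p} → Code n p → Set (c ⊔ ℓ ⊔ p)
  Intersecting 𝒞 = ∀ v w → 𝒞 v → 𝒞 w → NonZero v → NonZero w →
                   Σ _ λ i → ¬ (v i ≈ 0#) × ¬ (w i ≈ 0#)

  MinDistance : ∀ {n p} → Code n p → ℕ → Set (c ⊔ ℓ ⊔ p)
  MinDistance 𝒞 d =
    (Σ _ λ x → Σ _ λ y → 𝒞 x × 𝒞 y × ¬ (x ≈W y) × dist x y ≡ d) ×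
    (∀ x y → 𝒞 x → 𝒞 y → ¬ (x ≈W y) → d ≤ dist x y)

  -- W_i(𝒞) ≤ B : every list of pairwise distinct codewords of weight i
  -- has length at most B (i.e. |{x ∈ 𝒞 : w(x) = i}| ≤ B, counting words
  -- up to the field's equality)
  W≤ : ∀ {n p} → Code n p → ℕ → ℕ → Set (c ⊔ ℓ ⊔ p)
  W≤ 𝒞 i B = ∀ (xs : List (Word _)) →
             All (λ x → 𝒞 x × weight x ≡ i) xs →
             AllPairs (λ x y → ¬ (x ≈W y)) xs →
             length xs ≤ B

-- The map x ↦ (σ(x), value of x at the first point of σ(x)) is injective on the codewords of
-- weight d: two such codewords with the same support that agree at a point of it differ in fewer
-- than d coordinates. Its second component is one of the q − 1 nonzero symbols, so W_d is at most
-- q − 1 times the number of supports. These supports are d-sets which pairwise intersect and, as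
-- no coordinate lies in all of them, have no common point, so the Hilton–Milner theorem bounds
-- their number by C(n−1,d−1) − C(n−d−1,d−1) + 1.
--
-- Hilton–Milner is proved by Frankl's shifting, by induction on n, together with its version for
-- nonempty cross-intersecting pairs, |𝓐| + |𝓑| ≤ C(n,l) − C(n−l,l) + 1. Shifting element 0 to
-- element j + 1 preserves the hypotheses and lowers the number of members through 0, so one may
-- assume the families stable. Then the members avoiding 0 form an instance on n − 1 points, and
-- the members through 0, with 0 removed, still (cross-)intersect; bounding the two parts
-- separately and adding them with Pascal's rule gives the claim. For a single family, shifting
-- or stability can destroy nontriviality only when two points cover the family, a case in which
-- the cross-intersecting bound applies directly.

{-# OPTIONS --safe #-}
module Submission where

open import Data.Bool using (true; false)
import Data.Bool.Properties as Bool
open import Data.Empty using (⊥; ⊥-elim)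
open import Data.Fin using (Fin; zero; suc)
import Data.Fin.Properties as Fin
open import Data.Fin.Subset using (Subset; Side; inside; outside; ∁; ∣_∣)
import Data.Fin.Subset as Subset
open import Data.Fin.Subset.Properties using (∣p∣≤n; ∣p∣≤∣x∷p∣; ∣∁p∣≡n∸∣p∣; p⊂q⇒∣p∣<∣q∣)
open import Data.List using (List; []; _∷_; _++_; length; map; filter; allFin; cartesianProduct; deduplicate)
import Data.List as List
import Data.List.Membership.DecPropositional as DecMembership
open import Data.List.Membership.Propositional using (_∈_; _∉_; _─_; find; lose)
open import Data.List.Membership.Propositional.Properties
  using (∈-map⁺; ∈-map⁻; ∈-filter⁺; ∈-filter⁻; ∈-++⁻; ∈-++⁺ˡ; ∈-++⁺ʳ; ∈-tabulate⁺; ∈-allFin;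
         ∈-cartesianProduct⁺; ∈-deduplicate⁺; ∈-deduplicate⁻)
open import Data.List.Properties using (length-map; length-++; length-tabulate; length-removeAt′; filter-all; filter-none; filter-notAll)
open import Data.List.Relation.Binary.Disjoint.Propositional using (Disjoint)
open import Data.List.Relation.Binary.Subset.Propositional using (_⊆_)
open import Data.List.Relation.Unary.All as All using (All; []; _∷_)
import Data.List.Relation.Unary.All.Properties as All
open import Data.List.Relation.Unary.AllPairs using (AllPairs; []; _∷_)
open import Data.List.Relation.Unary.Any as Any using (here; there; index)
open import Data.List.Relation.Unary.Unique.DecPropositional.Properties using (deduplicate-!)
open import Data.List.Relation.Unary.Unique.Propositional using (Unique)
open import Data.List.Relation.Unary.Unique.Propositional.Properties using (filter⁺; map⁺; ++⁺)
open import Data.Maybe using (Maybe; just; nothing; maybe′)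
open import Data.Nat using (ℕ; zero; suc; _+_; _*_; _∸_; _≤_; _<_; _≤?_; z≤n; s≤s)
open import Data.Nat.Combinatorics using (_C_; nCn≡1; nCk≡nC[n∸k]; nCk+nC[k+1]≡[n+1]C[k+1])
open import Data.Nat.Properties
open import Algebra.Properties.CommutativeSemigroup +-commutativeSemigroup using () renaming (interchange to +-interchange)
open import Data.Product using (Σ; ∃; _×_; _,_; proj₁; proj₂)
open import Data.Sum using (_⊎_; inj₁; inj₂)
open import Data.Unit using (⊤; tt)
open import Data.Vec using ([]; _∷_; lookup; insertAt; removeAt; _[_]≔_)
import Data.Vec as Vec
open import Data.Vec.Properties
  using (∷-injectiveˡ; ∷-injectiveʳ; ≡-dec; []=⇒lookup; lookup⇒[]=;
         lookup∘tabulate; lookup∘update; lookup∘update′; insertAt-removeAt)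
open import Function using (id; _∘_)
open import Function.Bundles using (Inverse; Injection)
open import Function.Properties.Inverse using (Inverse⇒Injection) renaming (sym to ↔-sym)
open import Level using (Level)
open import Relation.Binary using (Rel; DecidableEquality)
open import Relation.Binary.PropositionalEquality
  using (_≡_; _≢_; refl; sym; trans; cong; cong₂; subst; subst₂; module ≡-Reasoning)
open import Relation.Nullary using (¬_; ¬¬-map; Dec; yes; no; does; ¬?; _×-dec_)
open import Relation.Nullary.Decidable using (decidable-stable; dec-true; dec-false)
open import Relation.Unary using (Pred; Decidable)

open import Defs

private
  variable
    a b : Level
    X : Set a
    Y : Set b
    n : ℕ

∈-─⁺ : ∀ {x y} {ys : List X} → x ∈ ys → (y∈ys : y ∈ ys) → x ≢ y → x ∈ ys ─ y∈ys
∈-─⁺ (here refl) (here refl) x≢y = ⊥-elim (x≢y refl)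
∈-─⁺ (here refl) (there _)   _   = here refl
∈-─⁺ (there x∈)  (here refl) _   = x∈
∈-─⁺ (there x∈)  (there y∈)  x≢y = there (∈-─⁺ x∈ y∈ x≢y)

Unique-⊆⇒length≤ : ∀ {xs ys : List X} → Unique xs → xs ⊆ ys → length xs ≤ length ys
Unique-⊆⇒length≤ {xs = []}     _             _     = z≤n
Unique-⊆⇒length≤ {xs = x ∷ xs} {ys} (x∉xs ∷ u) xs⊆ys = begin
  suc (length xs)          ≤⟨ s≤s (Unique-⊆⇒length≤ u xs⊆ys─x) ⟩
  suc (length (ys ─ x∈ys)) ≡⟨ length-removeAt′ ys (index x∈ys) ⟨
  length ys                ∎
  where
  open ≤-Reasoning
  x∈ys = xs⊆ys (here refl)
  xs⊆ys─x : xs ⊆ ys ─ x∈ys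
  xs⊆ys─x z∈xs = ∈-─⁺ (xs⊆ys (there z∈xs)) x∈ys (λ z≡x → All.lookup x∉xs z∈xs (sym z≡x))

Unique-map : ∀ {q r} {Q : Pred X q} {R : Rel X r} (f : X → Y) {xs} → All Q xs → AllPairs R xs →
             (∀ {x y} → Q x → Q y → R x y → f x ≢ f y) → Unique (map f xs)
Unique-map f []         []         _     = []
Unique-map f (qx ∷ qxs) (rx ∷ rxs) f-sep = distinct qxs rx ∷ Unique-map f qxs rxs f-sep
  where
  distinct : ∀ {ys} → All _ ys → All _ ys → All (f _ ≢_) (map f ys)
  distinct []         []         = []
  distinct (qy ∷ qys) (ry ∷ rys) = f-sep qx qy ry ∷ distinct qys rys

Unique-map-injectiveOn : (f : X → Y) {xs : List X} → (∀ {x y} → x ∈ xs → y ∈ xs → f x ≡ f y → x ≡ y) →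
                         Unique xs → Unique (map f xs)
Unique-map-injectiveOn f inj u = Unique-map f (All.tabulate id) u (λ x∈ y∈ x≢y → x≢y ∘ inj x∈ y∈)

length-cartesianProduct : (xs : List X) (ys : List Y) → length (cartesianProduct xs ys) ≡ length xs * length ys
length-cartesianProduct []       ys = refl
length-cartesianProduct (x ∷ xs) ys = trans (length-++ (map (x ,_) ys))
  (cong₂ _+_ (length-map (x ,_) ys) (length-cartesianProduct xs ys))

[]-or-∈ : (xs : List X) → xs ≡ [] ⊎ ∃ (_∈ xs)
[]-or-∈ []       = inj₁ refl
[]-or-∈ (x ∷ xs) = inj₂ (x , here refl)

length-filter-tabulate : ∀ {p} {P : Pred X p} (P? : Decidable P) (f : Fin n → X) →
                         length (filter P? (List.tabulate f)) ≡ ∣ Vec.tabulate (does ∘ P? ∘ f) ∣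
length-filter-tabulate {n = zero}  P? f = refl
length-filter-tabulate {n = suc n} P? f with does (P? (f zero))
... | true  = cong suc (length-filter-tabulate P? (f ∘ suc))
... | false = length-filter-tabulate P? (f ∘ suc)

¬¬-∀-Fin : ∀ {p} {P : Pred (Fin n) p} → (∀ i → ¬ ¬ P i) → ¬ ¬ (∀ i → P i)
¬¬-∀-Fin {n = zero}  _   ¬∀ = ¬∀ λ ()
¬¬-∀-Fin {n = suc n} ¬¬P ¬∀ =
  ¬¬P zero λ P0 → ¬¬-∀-Fin (¬¬P ∘ suc) λ P-suc → ¬∀ λ { zero → P0 ; (suc i) → P-suc i }

n+n<[1+n]+[1+n] : ∀ n → n + n < suc n + suc n
n+n<[1+n]+[1+n] n = s≤s (+-monoʳ-≤ n (n≤1+n n))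

m+m≤n+n⇒m≤n : ∀ {m n} → m + m ≤ n + n → m ≤ n
m+m≤n+n⇒m≤n {m} {n} 2m≤2n with m ≤? n
... | yes m≤n = m≤n
... | no  m≰n = ⊥-elim (<⇒≱ (+-mono-< (≰⇒> m≰n) (≰⇒> m≰n)) 2m≤2n)

m+n≤o+1⇒m≤o∸n+1 : ∀ m n o → m + n ≤ o + 1 → m ≤ o ∸ n + 1
m+n≤o+1⇒m≤o∸n+1 m zero    o       h = subst (_≤ o + 1) (+-identityʳ m) h
m+n≤o+1⇒m≤o∸n+1 m (suc n) zero    h = ≤-trans (m≤m+n m (suc n)) h
m+n≤o+1⇒m≤o∸n+1 m (suc n) (suc o) h = m+n≤o+1⇒m≤o∸n+1 m n o (≤-pred (subst (_≤ suc o + 1) (+-suc m n) h))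

nCk>0 : ∀ {n k} → k ≤ n → 0 < n C k
nCk>0 {n}     {zero}  _         = s≤s z≤n
nCk>0 {suc n} {suc k} (s≤s k≤n) =
  <-≤-trans (nCk>0 k≤n) (≤-trans (m≤m+n (n C k) _) (≤-reflexive (nCk+nC[k+1]≡[n+1]C[k+1] n k)))

pascal-split : ∀ {x₁ x₀} m c t → x₁ + c C t ≤ m C t → x₀ + c C suc t ≤ m C suc t + 1 →
               (x₁ + x₀) + suc c C suc t ≤ suc m C suc t + 1
pascal-split {x₁} {x₀} m c t bound₁ bound₀ = begin
  (x₁ + x₀) + suc c C suc t         ≡⟨ cong ((x₁ + x₀) +_) (nCk+nC[k+1]≡[n+1]C[k+1] c t) ⟨
  (x₁ + x₀) + (c C t + c C suc t)   ≡⟨ +-interchange x₁ x₀ _ _ ⟩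
  (x₁ + c C t) + (x₀ + c C suc t)   ≤⟨ +-mono-≤ bound₁ bound₀ ⟩
  m C t + (m C suc t + 1)           ≡⟨ +-assoc (m C t) _ 1 ⟨
  (m C t + m C suc t) + 1           ≡⟨ cong (_+ 1) (nCk+nC[k+1]≡[n+1]C[k+1] m t) ⟩
  suc m C suc t + 1                 ∎
  where open ≤-Reasoning

pascal-absorb : ∀ {x y} c t → t ≤ c → x + suc c C suc t ≤ y + 1 → x + c C suc t ≤ y
pascal-absorb {x} {y} c t t≤c bound = +-cancelʳ-≤ 1 _ _ (begin
  (x + c C suc t) + 1           ≡⟨ +-assoc x _ 1 ⟩
  x + (c C suc t + 1)           ≤⟨ +-monoʳ-≤ x (+-monoʳ-≤ (c C suc t) (nCk>0 t≤c)) ⟩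
  x + (c C suc t + c C t)       ≡⟨ cong (x +_) (trans (+-comm (c C suc t) _) (nCk+nC[k+1]≡[n+1]C[k+1] c t)) ⟩
  x + suc c C suc t             ≤⟨ bound ⟩
  y + 1                         ∎)
  where open ≤-Reasoning

-- Families of subsets

Family : ℕ → Set
Family n = List (Subset n)

-- A record rather than a product, so that Intersect A B determines A and B during unification.
record InBoth (A B : Subset n) (i : Fin n) : Set where
  constructor _,_
  field
    inˡ : lookup A i ≡ inside
    inʳ : lookup B i ≡ inside

Intersect : Subset n → Subset n → Set
Intersect {n} A B = Σ (Fin n) (InBoth A B)

Uniform : ℕ → Family n → Set
Uniform k 𝓕 = ∀ {A} → A ∈ 𝓕 → ∣ A ∣ ≡ k

CrossIntersecting : Family n → Family n → Set
CrossIntersecting 𝓐 𝓑 = ∀ {A B} → A ∈ 𝓐 → B ∈ 𝓑 → Intersect A B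

NonTrivial : Family n → Set
NonTrivial {n} 𝓕 = ∀ (i : Fin n) → Σ (Subset n) λ A → A ∈ 𝓕 × lookup A i ≡ outside

Intersect-sym : {A B : Subset n} → Intersect A B → Intersect B A
Intersect-sym (i , A∋i , B∋i) = i , B∋i , A∋i

CrossIntersecting-sym : {𝓐 𝓑 : Family n} → CrossIntersecting 𝓐 𝓑 → CrossIntersecting 𝓑 𝓐
CrossIntersecting-sym cross B∈ A∈ = Intersect-sym (cross A∈ B∈)

inside⇒∣∣≢0 : ∀ (A : Subset n) {i} → lookup A i ≡ inside → ∣ A ∣ ≢ 0
inside⇒∣∣≢0 (inside  ∷ A)         _ ()
inside⇒∣∣≢0 (outside ∷ A) {suc i} p = inside⇒∣∣≢0 A p

∣∣≡0⇒¬Intersect : ∀ (A : Subset n) {B} → ∣ A ∣ ≡ 0 → ¬ Intersect A B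
∣∣≡0⇒¬Intersect A ∣A∣≡0 (_ , A∋i , _) = inside⇒∣∣≢0 A A∋i ∣A∣≡0

∣∣≢0⇒inside : ∀ (A : Subset n) → ∣ A ∣ ≢ 0 → Σ (Fin n) λ i → lookup A i ≡ inside
∣∣≢0⇒inside []            ∣A∣≢0 = ⊥-elim (∣A∣≢0 refl)
∣∣≢0⇒inside (inside  ∷ A) _     = zero , refl
∣∣≢0⇒inside (outside ∷ A) ∣A∣≢0 = let (i , A∋i) = ∣∣≢0⇒inside A ∣A∣≢0 in suc i , A∋i

∣∣≡1⇒inside-unique : ∀ (A : Subset n) {i j} → ∣ A ∣ ≡ 1 →
                     lookup A i ≡ inside → lookup A j ≡ inside → i ≡ j
∣∣≡1⇒inside-unique (inside ∷ A)  {zero}  {zero}  _ _ _ = refl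
∣∣≡1⇒inside-unique (inside ∷ A)  {zero}  {suc j} e _ q = ⊥-elim (inside⇒∣∣≢0 A q (suc-injective e))
∣∣≡1⇒inside-unique (inside ∷ A)  {suc i}         e p _ = ⊥-elim (inside⇒∣∣≢0 A p (suc-injective e))
∣∣≡1⇒inside-unique (outside ∷ A) {suc i} {suc j} e p q = cong suc (∣∣≡1⇒inside-unique A e p q)

inside-outside⇒≢ : ∀ (A : Subset n) {i j} → lookup A i ≡ inside → lookup A j ≡ outside → i ≢ j
inside-outside⇒≢ A p q refl with trans (sym p) q
... | ()

outside-both : ∀ (A B : Subset n) → ∣ A ∣ + ∣ B ∣ < n →
               Σ (Fin n) λ j → lookup A j ≡ outside × lookup B j ≡ outside
outside-both (outside ∷ A) (outside ∷ B) _ = zero , refl , refl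
outside-both (inside  ∷ A) (y ∷ B) (s≤s h) =
  let (j , p , q) = outside-both A B (≤-<-trans (+-monoʳ-≤ ∣ A ∣ (∣p∣≤∣x∷p∣ y B)) h) in suc j , p , q
outside-both (outside ∷ A) (inside ∷ B) (s≤s h) =
  let (j , p , q) = outside-both A B (≤-trans (≤-reflexive (sym (+-suc ∣ A ∣ ∣ B ∣))) h) in suc j , p , q

∣∣+∣∁∣≡n : ∀ (A : Subset n) → ∣ A ∣ + ∣ ∁ A ∣ ≡ n
∣∣+∣∁∣≡n A = trans (cong (∣ A ∣ +_) (∣∁p∣≡n∸∣p∣ A)) (m+[n∸m]≡n (∣p∣≤n A))

∁-involutive : ∀ (A : Subset n) → ∁ (∁ A) ≡ A
∁-involutive []      = refl
∁-involutive (x ∷ A) = cong₂ _∷_ (Bool.not-involutive x) (∁-involutive A)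

∁-injective : {A B : Subset n} → ∁ A ≡ ∁ B → A ≡ B
∁-injective {A = A} {B} e = trans (sym (∁-involutive A)) (trans (cong ∁ e) (∁-involutive B))

¬Intersect-∁ : ∀ (A : Subset n) → ¬ Intersect A (∁ A)
¬Intersect-∁ (x ∷ A) (zero  , refl , ())
¬Intersect-∁ (x ∷ A) (suc i , p , q) = ¬Intersect-∁ A (i , p , q)

∣[]≔inside∣ : ∀ (A : Subset n) j → lookup A j ≡ outside → ∣ A [ j ]≔ inside ∣ ≡ suc ∣ A ∣
∣[]≔inside∣ (outside ∷ A) zero    _ = refl
∣[]≔inside∣ (inside  ∷ A) (suc j) p = cong suc (∣[]≔inside∣ A j p)
∣[]≔inside∣ (outside ∷ A) (suc j) p = ∣[]≔inside∣ A j p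

[]≔inside-injective : ∀ {A B : Subset n} j → lookup A j ≡ outside → lookup B j ≡ outside →
                      A [ j ]≔ inside ≡ B [ j ]≔ inside → A ≡ B
[]≔inside-injective {A = outside ∷ A} {outside ∷ B} zero    _ _ e = cong (outside ∷_) (∷-injectiveʳ e)
[]≔inside-injective {A = x ∷ A}       {y ∷ B}       (suc j) p q e =
  cong₂ _∷_ (∷-injectiveˡ e) ([]≔inside-injective j p q (∷-injectiveʳ e))

[]≔inside-mono : ∀ (A : Subset n) j {i} → lookup A i ≡ inside → lookup (A [ j ]≔ inside) i ≡ inside
[]≔inside-mono A j {i} A∋i with i Fin.≟ j
... | yes refl = lookup∘update i A inside
... | no  i≢j  = trans (lookup∘update′ i≢j A inside) A∋i

Intersect-[]≔inside : ∀ {A B : Subset n} {j} → lookup A j ≡ outside → Intersect A (B [ j ]≔ inside) → Intersect A B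
Intersect-[]≔inside {A = A} {B} A∌j (i , A∋i , B′∋i) =
  i , A∋i , trans (sym (lookup∘update′ (inside-outside⇒≢ A A∋i A∌j) B inside)) B′∋i

∣insertAt-inside∣ : ∀ (A : Subset n) i → ∣ insertAt A i inside ∣ ≡ suc ∣ A ∣
∣insertAt-inside∣ A             zero    = refl
∣insertAt-inside∣ (inside  ∷ A) (suc i) = cong suc (∣insertAt-inside∣ A i)
∣insertAt-inside∣ (outside ∷ A) (suc i) = ∣insertAt-inside∣ A i

∣insertAt-outside∣ : ∀ (A : Subset n) i → ∣ insertAt A i outside ∣ ≡ ∣ A ∣
∣insertAt-outside∣ A             zero    = refl
∣insertAt-outside∣ (inside  ∷ A) (suc i) = cong suc (∣insertAt-outside∣ A i)
∣insertAt-outside∣ (outside ∷ A) (suc i) = ∣insertAt-outside∣ A i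

Intersect-insertAt-outside : ∀ {A B : Subset n} i {y} → Intersect (insertAt A i outside) (insertAt B i y) →
                             Intersect A B
Intersect-insertAt-outside zero (suc k , p , q) = k , p , q
Intersect-insertAt-outside {A = _ ∷ A} {_ ∷ B} (suc i) (zero , p , q) = zero , p , q
Intersect-insertAt-outside {A = _ ∷ A} {_ ∷ B} (suc i) (suc k , p , q) =
  let (k′ , p′ , q′) = Intersect-insertAt-outside i (k , p , q) in suc k′ , p′ , q′

Intersect-∷⁻ˡ : ∀ {A B : Subset n} {y} → Intersect (outside ∷ A) (y ∷ B) → Intersect A B
Intersect-∷⁻ˡ = Intersect-insertAt-outside zero

Intersect-∷⁻ʳ : ∀ {A B : Subset n} {x} → Intersect (x ∷ A) (outside ∷ B) → Intersect A B
Intersect-∷⁻ʳ (zero  , _ , ())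
Intersect-∷⁻ʳ (suc i , p , q) = i , p , q

∣removeAt-outside∣ : ∀ (A : Subset (suc n)) i → lookup A i ≡ outside → ∣ removeAt A i ∣ ≡ ∣ A ∣
∣removeAt-outside∣ A i A∌i = begin
  ∣ removeAt A i ∣                            ≡⟨ ∣insertAt-outside∣ (removeAt A i) i ⟨
  ∣ insertAt (removeAt A i) i outside ∣       ≡⟨ cong (λ x → ∣ insertAt (removeAt A i) i x ∣) A∌i ⟨
  ∣ insertAt (removeAt A i) i (lookup A i) ∣  ≡⟨ cong ∣_∣ (insertAt-removeAt A i) ⟩
  ∣ A ∣                                       ∎
  where open ≡-Reasoning

Intersect-removeAt : ∀ {A : Subset n} {B : Subset (suc n)} i {x} → lookup B i ≡ outside →
                     Intersect (insertAt A i x) B → Intersect A (removeAt B i)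
Intersect-removeAt {A = A} {B} i B∌i A∩B =
  Intersect-sym (Intersect-insertAt-outside i (Intersect-sym (subst (Intersect _) B-restored A∩B)))
  where
  B-restored : B ≡ insertAt (removeAt B i) i outside
  B-restored = trans (sym (insertAt-removeAt B i)) (cong (insertAt (removeAt B i) i) B∌i)

removeAt-injective : ∀ {A B : Subset (suc n)} i → lookup A i ≡ lookup B i → removeAt A i ≡ removeAt B i → A ≡ B
removeAt-injective {A = A} {B} i p e = begin
  A                                          ≡⟨ insertAt-removeAt A i ⟨
  insertAt (removeAt A i) i (lookup A i)     ≡⟨ cong₂ (λ D x → insertAt D i x) e p ⟩
  insertAt (removeAt B i) i (lookup B i)     ≡⟨ insertAt-removeAt B i ⟩
  B                                          ∎
  where open ≡-Reasoning

_≟ₛ_ : DecidableEquality (Subset n)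
_≟ₛ_ = ≡-dec Bool._≟_

side? : ∀ (i : Fin n) b (A : Subset n) → Dec (lookup A i ≡ b)
side? i b A = lookup A i Bool.≟ b

_∈?_ : ∀ (A : Subset n) (𝓕 : Family n) → Dec (A ∈ 𝓕)
A ∈? 𝓕 = DecMembership._∈?_ _≟ₛ_ A 𝓕

indicator : ∀ {p} {P : Pred (Fin n) p} → Decidable P → Subset n
indicator P? = Vec.tabulate (does ∘ P?)

length-filter-allFin : ∀ {p} {P : Pred (Fin n) p} (P? : Decidable P) → length (filter P? (allFin n)) ≡ ∣ indicator P? ∣
length-filter-allFin P? = length-filter-tabulate P? id

indicator-inside : ∀ {p} {P : Pred (Fin n) p} (P? : Decidable P) {i} → P i → lookup (indicator P?) i ≡ inside
indicator-inside P? {i} Pi = trans (lookup∘tabulate (does ∘ P?) i) (dec-true (P? i) Pi)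

indicator-outside : ∀ {p} {P : Pred (Fin n) p} (P? : Decidable P) {i} → ¬ P i → lookup (indicator P?) i ≡ outside
indicator-outside P? {i} ¬Pi = trans (lookup∘tabulate (does ∘ P?) i) (dec-false (P? i) ¬Pi)

indicator-inside⁻ : ∀ {p} {P : Pred (Fin n) p} (P? : Decidable P) {i} → lookup (indicator P?) i ≡ inside → P i
indicator-inside⁻ P? {i} inside≡ with P? i | lookup∘tabulate (does ∘ P?) i
... | yes Pi | _ = Pi
... | no  _  | e with () ← trans (sym inside≡) e

pivot : Subset n → Maybe (Fin n)
pivot A with Fin.any? (λ i → side? i inside A)
... | yes (i , _) = just i
... | no  _       = nothing

pivot-inside : ∀ (A : Subset n) {i} → lookup A i ≡ inside → Σ (Fin n) λ j → pivot A ≡ just j × lookup A j ≡ inside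
pivot-inside A A∋i with Fin.any? (λ i → side? i inside A)
... | yes (j , A∋j) = j , refl , A∋j
... | no  none      = ⊥-elim (none (_ , A∋i))

nonTrivial-or-common : ∀ (𝓕 : Family n) → NonTrivial 𝓕 ⊎ Σ (Fin n) λ i → ∀ {A} → A ∈ 𝓕 → lookup A i ≡ inside
nonTrivial-or-common {n} 𝓕 with Fin.all? (λ i → Any.any? (side? i outside) 𝓕)
... | yes nt = inj₁ (find ∘ nt)
... | no ¬nt = let (i , none-outside) = Fin.¬∀⟶∃¬ n _ (λ i → Any.any? (side? i outside) 𝓕) ¬nt in
               inj₂ (i , λ A∈ → Bool.¬-not (none-outside ∘ lose A∈))

slice : Fin (suc n) → Side → Family (suc n) → Family n
slice i b 𝓕 = map (λ A → removeAt A i) (filter (side? i b) 𝓕)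

length-slices : ∀ i (𝓕 : Family (suc n)) → length 𝓕 ≡ length (slice i inside 𝓕) + length (slice i outside 𝓕)
length-slices i []      = refl
length-slices i (A ∷ 𝓕) with lookup A i
... | inside  = cong suc (length-slices i 𝓕)
... | outside = trans (cong suc (length-slices i 𝓕)) (sym (+-suc _ _))

length-slice-all : ∀ i b {𝓕 : Family (suc n)} → (∀ {A} → A ∈ 𝓕 → lookup A i ≡ b) → length (slice i b 𝓕) ≡ length 𝓕
length-slice-all i b {𝓕} all-b =
  trans (length-map (λ A → removeAt A i) (filter (side? i b) 𝓕)) (cong length (filter-all (side? i b) (All.tabulate all-b)))

length-slice-none : ∀ i b {𝓕 : Family (suc n)} → (∀ {A} → A ∈ 𝓕 → lookup A i ≢ b) → length (slice i b 𝓕) ≡ 0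
length-slice-none i b {𝓕} none-b =
  trans (length-map (λ A → removeAt A i) (filter (side? i b) 𝓕)) (cong length (filter-none (side? i b) (All.tabulate none-b)))

∈-slice⁺ : ∀ {i b} {𝓕 : Family (suc n)} {A} → A ∈ 𝓕 → lookup A i ≡ b → removeAt A i ∈ slice i b 𝓕
∈-slice⁺ A∈𝓕 A[i]≡b = ∈-map⁺ _ (∈-filter⁺ _ A∈𝓕 A[i]≡b)

∈-slice⁻ : ∀ {i b} {𝓕 : Family (suc n)} {A} → A ∈ slice i b 𝓕 → insertAt A i b ∈ 𝓕
∈-slice⁻ {i = i} {b} {𝓕} A∈ with ∈-map⁻ _ A∈
... | D , D∈ , refl with ∈-filter⁻ (side? i b) {xs = 𝓕} D∈
... | D∈𝓕 , refl = subst (_∈ 𝓕) (sym (insertAt-removeAt D i)) D∈𝓕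

slice-Unique : ∀ i b {𝓕 : Family (suc n)} → Unique 𝓕 → Unique (slice i b 𝓕)
slice-Unique i b {𝓕} u = Unique-map-injectiveOn _ removeAt-injectiveOn (filter⁺ _ u)
  where
  removeAt-injectiveOn : ∀ {A B} → A ∈ filter (side? i b) 𝓕 → B ∈ filter (side? i b) 𝓕 →
                         removeAt A i ≡ removeAt B i → A ≡ B
  removeAt-injectiveOn A∈ B∈ = removeAt-injective i
    (trans (proj₂ (∈-filter⁻ (side? i b) {xs = 𝓕} A∈)) (sym (proj₂ (∈-filter⁻ (side? i b) {xs = 𝓕} B∈))))

slice-inside-Uniform : ∀ {k} i {𝓕 : Family (suc n)} → Uniform (suc k) 𝓕 → Uniform k (slice i inside 𝓕)
slice-inside-Uniform i U {A} A∈ = suc-injective (trans (sym (∣insertAt-inside∣ A i)) (U (∈-slice⁻ A∈)))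

slice-outside-Uniform : ∀ {k} i {𝓕 : Family (suc n)} → Uniform k 𝓕 → Uniform k (slice i outside 𝓕)
slice-outside-Uniform i U {A} A∈ = trans (sym (∣insertAt-outside∣ A i)) (U (∈-slice⁻ A∈))

length≤C : ∀ m t (𝓕 : Family m) → Unique 𝓕 → Uniform t 𝓕 → length 𝓕 ≤ m C t
length≤C zero    zero    𝓕        u _ = Unique-⊆⇒length≤ {ys = [] ∷ []} u λ { {[]} _ → here refl }
length≤C zero    (suc t) []       _ _ = z≤n
length≤C zero    (suc t) ([] ∷ _) _ U with () ← U (here refl)
length≤C (suc m) zero    𝓕        u U = begin
  length 𝓕                  ≡⟨ length-slices zero 𝓕 ⟩
  length 𝓕₁ + length 𝓕₀     ≡⟨ cong (_+ length 𝓕₀) 𝓕₁-empty ⟩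
  length 𝓕₀                 ≤⟨ length≤C m zero 𝓕₀ (slice-Unique zero outside u) (slice-outside-Uniform zero U) ⟩
  1                          ∎
  where
  open ≤-Reasoning
  𝓕₁ = slice zero inside 𝓕
  𝓕₀ = slice zero outside 𝓕
  𝓕₁-empty = length-slice-none zero inside λ {A} A∈ A∋0 → inside⇒∣∣≢0 A A∋0 (U A∈)
length≤C (suc m) (suc t) 𝓕        u U = begin
  length 𝓕                  ≡⟨ length-slices zero 𝓕 ⟩
  length 𝓕₁ + length 𝓕₀     ≤⟨ +-mono-≤ (length≤C m t 𝓕₁ (slice-Unique zero inside u) (slice-inside-Uniform zero U))
                                         (length≤C m (suc t) 𝓕₀ (slice-Unique zero outside u) (slice-outside-Uniform zero U)) ⟩
  m C t + m C suc t          ≡⟨ nCk+nC[k+1]≡[n+1]C[k+1] m t ⟩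
  suc m C suc t              ∎
  where
  open ≤-Reasoning
  𝓕₁ = slice zero inside 𝓕
  𝓕₀ = slice zero outside 𝓕

-- (m ∸ ∣ S ∣) C t counts the t-sets disjoint from S.
meeting-length+C≤C : ∀ m t (S : Subset m) (𝓕 : Family m) → Unique 𝓕 → Uniform t 𝓕 →
                     (∀ {A} → A ∈ 𝓕 → Intersect A S) → length 𝓕 + (m ∸ ∣ S ∣) C t ≤ m C t
meeting-length+C≤C m       zero    S  []      _ _ _    = ≤-refl
meeting-length+C≤C m       zero    S  (A ∷ _) _ U meet = ⊥-elim (∣∣≡0⇒¬Intersect A (U (here refl)) (meet (here refl)))
meeting-length+C≤C zero    (suc t) [] []      _ _ _    = z≤n
meeting-length+C≤C zero    (suc t) [] (A ∷ _) _ _ meet with () , _ ← meet (here refl)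
meeting-length+C≤C (suc m) (suc t) (inside ∷ S) 𝓕 u U meet = begin
  length 𝓕 + c C suc t                  ≡⟨ cong (_+ c C suc t) (length-slices zero 𝓕) ⟩
  (length 𝓕₁ + length 𝓕₀) + c C suc t  ≡⟨ +-assoc (length 𝓕₁) _ _ ⟩
  length 𝓕₁ + (length 𝓕₀ + c C suc t)  ≤⟨ +-mono-≤ 𝓕₁-bound 𝓕₀-bound ⟩
  m C t + m C suc t                      ≡⟨ nCk+nC[k+1]≡[n+1]C[k+1] m t ⟩
  suc m C suc t                          ∎
  where
  open ≤-Reasoning
  c = m ∸ ∣ S ∣
  𝓕₁ = slice zero inside 𝓕
  𝓕₀ = slice zero outside 𝓕
  𝓕₁-bound : length 𝓕₁ ≤ m C t
  𝓕₁-bound = length≤C m t 𝓕₁ (slice-Unique zero inside u) (slice-inside-Uniform zero U)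
  𝓕₀-bound : length 𝓕₀ + c C suc t ≤ m C suc t
  𝓕₀-bound = meeting-length+C≤C m (suc t) S 𝓕₀ (slice-Unique zero outside u) (slice-outside-Uniform zero U)
               (Intersect-∷⁻ˡ ∘ meet ∘ ∈-slice⁻)
meeting-length+C≤C (suc m) (suc t) (outside ∷ S) 𝓕 u U meet = begin
  length 𝓕 + (suc m ∸ ∣ S ∣) C suc t             ≡⟨ cong₂ (λ l k → l + k C suc t) (length-slices zero 𝓕) (+-∸-assoc 1 (∣p∣≤n S)) ⟩
  (length 𝓕₁ + length 𝓕₀) + suc c C suc t        ≡⟨ cong ((length 𝓕₁ + length 𝓕₀) +_) (nCk+nC[k+1]≡[n+1]C[k+1] c t) ⟨
  (length 𝓕₁ + length 𝓕₀) + (c C t + c C suc t)  ≡⟨ +-interchange (length 𝓕₁) _ _ _ ⟩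
  (length 𝓕₁ + c C t) + (length 𝓕₀ + c C suc t)  ≤⟨ +-mono-≤ 𝓕₁-bound 𝓕₀-bound ⟩
  m C t + m C suc t                               ≡⟨ nCk+nC[k+1]≡[n+1]C[k+1] m t ⟩
  suc m C suc t                                   ∎
  where
  open ≤-Reasoning
  c = m ∸ ∣ S ∣
  𝓕₁ = slice zero inside 𝓕
  𝓕₀ = slice zero outside 𝓕
  𝓕₁-bound : length 𝓕₁ + c C t ≤ m C t
  𝓕₁-bound = meeting-length+C≤C m t S 𝓕₁ (slice-Unique zero inside u) (slice-inside-Uniform zero U)
               (Intersect-∷⁻ʳ ∘ meet ∘ ∈-slice⁻)
  𝓕₀-bound : length 𝓕₀ + c C suc t ≤ m C suc t
  𝓕₀-bound = meeting-length+C≤C m (suc t) S 𝓕₀ (slice-Unique zero outside u) (slice-outside-Uniform zero U)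
               (Intersect-∷⁻ʳ ∘ meet ∘ ∈-slice⁻)

-- The complements of the members of 𝓐 are l-sets disjoint from the members of 𝓑, hence distinct from them.
crossIntersecting-length≤C : ∀ {l} (𝓐 𝓑 : Family n) → l + l ≡ n → Unique 𝓐 → Unique 𝓑 →
                             Uniform l 𝓐 → Uniform l 𝓑 → CrossIntersecting 𝓐 𝓑 → length 𝓐 + length 𝓑 ≤ n C l
crossIntersecting-length≤C {n} {l} 𝓐 𝓑 l+l≡n u𝓐 u𝓑 U𝓐 U𝓑 cross = begin
  length 𝓐 + length 𝓑            ≡⟨ cong (_+ length 𝓑) (length-map ∁ 𝓐) ⟨
  length (map ∁ 𝓐) + length 𝓑    ≡⟨ length-++ (map ∁ 𝓐) ⟨
  length (map ∁ 𝓐 ++ 𝓑)          ≤⟨ length≤C n l _ (++⁺ (map⁺ ∁-injective u𝓐) u𝓑 disjoint) uniform ⟩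
  n C l                           ∎
  where
  open ≤-Reasoning
  disjoint : Disjoint (map ∁ 𝓐) 𝓑
  disjoint (A′∈ , B∈) with ∈-map⁻ ∁ A′∈
  ... | A , A∈ , refl = ¬Intersect-∁ A (cross A∈ B∈)
  uniform : Uniform l (map ∁ 𝓐 ++ 𝓑)
  uniform A′∈ with ∈-++⁻ (map ∁ 𝓐) A′∈
  ... | inj₂ B∈ = U𝓑 B∈
  ... | inj₁ A′∈ with ∈-map⁻ ∁ A′∈
  ... | A , A∈ , refl = +-cancelˡ-≡ l _ _ (trans (cong (_+ ∣ ∁ A ∣) (sym (U𝓐 A∈))) (trans (∣∣+∣∁∣≡n A) (sym l+l≡n)))

-- Shifting

Movable : Family (suc n) → Fin n → Subset n → Set
Movable 𝓕 j A = lookup A j ≡ outside × (outside ∷ A [ j ]≔ inside) ∉ 𝓕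

movable? : ∀ (𝓕 : Family (suc n)) j A → Dec (Movable 𝓕 j A)
movable? 𝓕 j A = side? j outside A ×-dec ¬? ((outside ∷ A [ j ]≔ inside) ∈? 𝓕)

shiftMember : Family (suc n) → Fin n → Subset (suc n) → Subset (suc n)
shiftMember 𝓕 j (outside ∷ A) = outside ∷ A
shiftMember 𝓕 j (inside  ∷ A) with movable? 𝓕 j A
... | yes _ = outside ∷ A [ j ]≔ inside
... | no  _ = inside ∷ A

shift : Fin n → Family (suc n) → Family (suc n)
shift j 𝓕 = map (shiftMember 𝓕 j) 𝓕

Stays : Family (suc n) → Fin n → Subset (suc n) → Set
Stays 𝓕 j (outside ∷ A) = ⊤
Stays 𝓕 j (inside  ∷ A) = lookup A j ≡ outside → (outside ∷ A [ j ]≔ inside) ∈ 𝓕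

Stable : Family (suc n) → Set
Stable 𝓕 = ∀ j {A} → A ∈ 𝓕 → Stays 𝓕 j A

data ShiftView (𝓕 : Family (suc n)) (j : Fin n) : Subset (suc n) → Subset (suc n) → Set where
  stays : ∀ {A} → Stays 𝓕 j A → ShiftView 𝓕 j A A
  moves : ∀ {A} → Movable 𝓕 j A → ShiftView 𝓕 j (inside ∷ A) (outside ∷ A [ j ]≔ inside)

shift-view : ∀ (𝓕 : Family (suc n)) j A → ShiftView 𝓕 j A (shiftMember 𝓕 j A)
shift-view 𝓕 j (outside ∷ A) = stays tt
shift-view 𝓕 j (inside  ∷ A) with movable? 𝓕 j A
... | yes movable = moves movable
... | no ¬movable = stays λ A∌j → decidable-stable (_ ∈? 𝓕) (λ ∉𝓕 → ¬movable (A∌j , ∉𝓕))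

shift-Uniform : ∀ {k} j {𝓕 : Family (suc n)} → Uniform k 𝓕 → Uniform k (shift j 𝓕)
shift-Uniform j {𝓕} U A′∈ with ∈-map⁻ (shiftMember 𝓕 j) A′∈
... | A , A∈ , refl with shiftMember 𝓕 j A | shift-view 𝓕 j A
... | _ | stays _          = U A∈
... | _ | moves {A₀} (A∌j , _) = trans (∣[]≔inside∣ A₀ j A∌j) (U A∈)

shift-Unique : ∀ j {𝓕 : Family (suc n)} → Unique 𝓕 → Unique (shift j 𝓕)
shift-Unique j {𝓕} = Unique-map-injectiveOn (shiftMember 𝓕 j) injective
  where
  injective : ∀ {A B} → A ∈ 𝓕 → B ∈ 𝓕 → shiftMember 𝓕 j A ≡ shiftMember 𝓕 j B → A ≡ B
  injective {A} {B} A∈ B∈ e with shiftMember 𝓕 j A | shift-view 𝓕 j A | shiftMember 𝓕 j B | shift-view 𝓕 j B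
  ... | _ | stays _ | _ | stays _ = e
  ... | _ | moves (A∌j , _) | _ | moves (B∌j , _) = cong (inside ∷_) ([]≔inside-injective j A∌j B∌j (∷-injectiveʳ e))
  ... | _ | moves (_ , ∉𝓕)  | _ | stays _ = ⊥-elim (∉𝓕 (subst (_∈ 𝓕) (sym e) B∈))
  ... | _ | stays _ | _ | moves (_ , ∉𝓕)  = ⊥-elim (∉𝓕 (subst (_∈ 𝓕) e A∈))

moves-Intersect-stays : ∀ {𝓐 𝓑 : Family (suc n)} {j A B} → CrossIntersecting 𝓐 𝓑 → (inside ∷ A) ∈ 𝓐 →
                        lookup A j ≡ outside → B ∈ 𝓑 → Stays 𝓑 j B → Intersect (outside ∷ A [ j ]≔ inside) B
moves-Intersect-stays {j = j} {A} {outside ∷ B} cross A∈ _ B∈ _ with Intersect-∷⁻ʳ (cross A∈ B∈)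
... | i , A∋i , B∋i = suc i , []≔inside-mono A j A∋i , B∋i
moves-Intersect-stays {j = j} {A} {inside ∷ B} cross A∈ A∌j B∈ B-stays with lookup B j in B[j]
... | inside  = suc j , lookup∘update j A inside , B[j]
... | outside = let (i , A∋i , B∋i) = Intersect-[]≔inside A∌j (Intersect-∷⁻ʳ (cross A∈ (B-stays refl)))
                in suc i , []≔inside-mono A j A∋i , B∋i

shift-CrossIntersecting : ∀ j {𝓐 𝓑 : Family (suc n)} → CrossIntersecting 𝓐 𝓑 → CrossIntersecting (shift j 𝓐) (shift j 𝓑)
shift-CrossIntersecting j {𝓐} {𝓑} cross A′∈ B′∈ with ∈-map⁻ (shiftMember 𝓐 j) A′∈ | ∈-map⁻ (shiftMember 𝓑 j) B′∈
... | A , A∈ , refl | B , B∈ , refl with shiftMember 𝓐 j A | shift-view 𝓐 j A | shiftMember 𝓑 j B | shift-view 𝓑 j B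
... | _ | stays _          | _ | stays _          = cross A∈ B∈
... | _ | moves (A∌j , _) | _ | stays sB          = moves-Intersect-stays cross A∈ A∌j B∈ sB
... | _ | stays sA         | _ | moves (B∌j , _) =
  Intersect-sym (moves-Intersect-stays (CrossIntersecting-sym cross) B∈ B∌j A∈ sA)
... | _ | moves {A₀} _     | _ | moves {B₀} _     = suc j , lookup∘update j A₀ inside , lookup∘update j B₀ inside

shiftMember-outside : ∀ (𝓕 : Family (suc n)) j A {i} → i ≢ suc j → lookup A i ≡ outside → lookup (shiftMember 𝓕 j A) i ≡ outside
shiftMember-outside 𝓕 j A {i} i≢j+1 A∌i with shiftMember 𝓕 j A | shift-view 𝓕 j A | i
... | _ | stays _      | _     = A∌i
... | _ | moves _      | zero  = refl
... | _ | moves {A₀} _ | suc i = trans (lookup∘update′ (i≢j+1 ∘ cong suc) A₀ inside) A∌i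

shift-NonTrivial : ∀ j {𝓕 : Family (suc n)} {B} → NonTrivial 𝓕 → (outside ∷ B) ∈ 𝓕 → lookup B j ≡ outside →
                   NonTrivial (shift j 𝓕)
shift-NonTrivial j {𝓕} {B} nt B∈ B∌j i with i Fin.≟ suc j
... | yes refl  = outside ∷ B , ∈-map⁺ (shiftMember 𝓕 j) B∈ , B∌j
... | no i≢j+1 = let (A , A∈ , A∌i) = nt i in
                 shiftMember 𝓕 j A , ∈-map⁺ (shiftMember 𝓕 j) A∈ , shiftMember-outside 𝓕 j A i≢j+1 A∌i

deg₀ : Family (suc n) → ℕ
deg₀ 𝓕 = length (slice zero inside 𝓕)

deg₀-∷ : ∀ A (𝓕 : Family (suc n)) → deg₀ (A ∷ 𝓕) ≡ deg₀ (A ∷ []) + deg₀ 𝓕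
deg₀-∷ (inside  ∷ A) 𝓕 = refl
deg₀-∷ (outside ∷ A) 𝓕 = refl

deg₀-shift≤ : ∀ (𝓕 : Family (suc n)) j 𝓖 → deg₀ (map (shiftMember 𝓕 j) 𝓖) ≤ deg₀ 𝓖
deg₀-shift≤ 𝓕 j []      = z≤n
deg₀-shift≤ 𝓕 j (A ∷ 𝓖) with shiftMember 𝓕 j A | shift-view 𝓕 j A
... | _ | moves _ = m≤n⇒m≤1+n (deg₀-shift≤ 𝓕 j 𝓖)
... | _ | stays _ = subst₂ _≤_ (sym (deg₀-∷ A _)) (sym (deg₀-∷ A 𝓖)) (+-monoʳ-≤ (deg₀ (A ∷ [])) (deg₀-shift≤ 𝓕 j 𝓖))

deg₀-shift< : ∀ (𝓕 : Family (suc n)) j {A} 𝓖 → (inside ∷ A) ∈ 𝓖 → Movable 𝓕 j A → deg₀ (map (shiftMember 𝓕 j) 𝓖) < deg₀ 𝓖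
deg₀-shift< 𝓕 j {A} (_ ∷ 𝓖) (here refl) movable with movable? 𝓕 j A
... | yes _       = s≤s (deg₀-shift≤ 𝓕 j 𝓖)
... | no ¬movable = ⊥-elim (¬movable movable)
deg₀-shift< 𝓕 j (B ∷ 𝓖) (there A∈) movable with shiftMember 𝓕 j B | shift-view 𝓕 j B
... | _ | moves _ = m<n⇒m<1+n (deg₀-shift< 𝓕 j 𝓖 A∈ movable)
... | _ | stays _ =
  subst₂ _<_ (sym (deg₀-∷ B _)) (sym (deg₀-∷ B 𝓖)) (+-monoʳ-< (deg₀ (B ∷ [])) (deg₀-shift< 𝓕 j 𝓖 A∈ movable))

stable-or-shiftable : ∀ (𝓕 : Family (suc n)) → Stable 𝓕 ⊎ Σ (Fin n) λ j → deg₀ (shift j 𝓕) < deg₀ 𝓕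
stable-or-shiftable 𝓕 with Fin.any? (λ j → Any.any? (movable? 𝓕 j) (slice zero inside 𝓕))
... | yes (j , some-movable) = let (A , A∈ , movable) = find some-movable in inj₂ (j , deg₀-shift< 𝓕 j 𝓕 (∈-slice⁻ A∈) movable)
... | no none-movable        = inj₁ stable
  where
  stable : Stable 𝓕
  stable j {outside ∷ A} _  = tt
  stable j {inside  ∷ A} A∈ A∌j = decidable-stable (_ ∈? 𝓕) λ ∉𝓕 → none-movable (j , lose (∈-slice⁺ A∈ refl) (A∌j , ∉𝓕))

stable-or-shiftable₂ : ∀ (𝓐 𝓑 : Family (suc n)) →
  (Stable 𝓐 × Stable 𝓑) ⊎ Σ (Fin n) λ j → deg₀ (shift j 𝓐) + deg₀ (shift j 𝓑) < deg₀ 𝓐 + deg₀ 𝓑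
stable-or-shiftable₂ 𝓐 𝓑 with stable-or-shiftable 𝓐 | stable-or-shiftable 𝓑
... | inj₁ st𝓐       | inj₁ st𝓑       = inj₁ (st𝓐 , st𝓑)
... | inj₂ (j , 𝓐<) | _              = inj₂ (j , +-mono-<-≤ 𝓐< (deg₀-shift≤ 𝓑 j 𝓑))
... | inj₁ _         | inj₂ (j , 𝓑<) = inj₂ (j , +-mono-≤-< (deg₀-shift≤ 𝓐 j 𝓐) 𝓑<)

Stable⇒outside₀-nonempty : ∀ {𝓕 : Family (suc n)} → Stable 𝓕 → ∀ {A} → A ∈ 𝓕 → ∣ A ∣ + ∣ A ∣ ≤ n →
                           ∃ (_∈ slice zero outside 𝓕)
Stable⇒outside₀-nonempty st {outside ∷ A} A∈ _ = A , ∈-slice⁺ A∈ refl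
Stable⇒outside₀-nonempty st {inside  ∷ A} A∈ 2∣A∣<n
  with j , A∌j , _ ← outside-both A A (≤-trans (s≤s (+-monoʳ-≤ ∣ A ∣ (n≤1+n ∣ A ∣))) 2∣A∣<n)
  = A [ j ]≔ inside , ∈-slice⁺ (st j A∈ A∌j) refl

Stable⇒inside₀-Intersect : ∀ {𝓐 𝓑 : Family (suc n)} → Stable 𝓑 → CrossIntersecting 𝓐 𝓑 →
                           ∀ {A B} → A ∈ slice zero inside 𝓐 → B ∈ slice zero inside 𝓑 → ∣ A ∣ + ∣ B ∣ < n → Intersect A B
Stable⇒inside₀-Intersect st cross {A} {B} A∈ B∈ ∣A∣+∣B∣<n
  with j , A∌j , B∌j ← outside-both A B ∣A∣+∣B∣<n
  = Intersect-[]≔inside A∌j (Intersect-∷⁻ʳ (cross (∈-slice⁻ A∈) (st j (∈-slice⁻ B∈) B∌j)))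

-- The Hilton–Milner theorem and its cross-intersecting version

record NonemptyCrossIntersecting (l : ℕ) (𝓐 𝓑 : Family n) : Set where
  field
    unique₁   : Unique 𝓐
    unique₂   : Unique 𝓑
    uniform₁  : Uniform l 𝓐
    uniform₂  : Uniform l 𝓑
    cross     : CrossIntersecting 𝓐 𝓑
    nonempty₁ : ∃ (_∈ 𝓐)
    nonempty₂ : ∃ (_∈ 𝓑)

NonemptyCrossIntersecting⇒l≢0 : ∀ {l} {𝓐 𝓑 : Family n} → NonemptyCrossIntersecting l 𝓐 𝓑 → l ≢ 0
NonemptyCrossIntersecting⇒l≢0 P l≡0 =
  let (A , A∈) = nonempty₁ ; (B , B∈) = nonempty₂ in ∣∣≡0⇒¬Intersect A (trans (uniform₁ A∈) l≡0) (cross A∈ B∈)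
  where open NonemptyCrossIntersecting P

module _ {l} {𝓐 𝓑 : Family (suc n)} (P : NonemptyCrossIntersecting l 𝓐 𝓑) where
  open NonemptyCrossIntersecting P

  shift-NonemptyCrossIntersecting : ∀ j → NonemptyCrossIntersecting l (shift j 𝓐) (shift j 𝓑)
  shift-NonemptyCrossIntersecting j = record
    { unique₁   = shift-Unique j unique₁
    ; unique₂   = shift-Unique j unique₂
    ; uniform₁  = shift-Uniform j uniform₁
    ; uniform₂  = shift-Uniform j uniform₂
    ; cross     = shift-CrossIntersecting j cross
    ; nonempty₁ = let (A , A∈) = nonempty₁ in shiftMember 𝓐 j A , ∈-map⁺ (shiftMember 𝓐 j) A∈
    ; nonempty₂ = let (B , B∈) = nonempty₂ in shiftMember 𝓑 j B , ∈-map⁺ (shiftMember 𝓑 j) B∈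
    }

  Stable⇒outside₀-NonemptyCrossIntersecting : Stable 𝓐 → Stable 𝓑 → l + l ≤ n →
    NonemptyCrossIntersecting l (slice zero outside 𝓐) (slice zero outside 𝓑)
  Stable⇒outside₀-NonemptyCrossIntersecting st𝓐 st𝓑 2l≤n = record
    { unique₁   = slice-Unique zero outside unique₁
    ; unique₂   = slice-Unique zero outside unique₂
    ; uniform₁  = slice-outside-Uniform zero uniform₁
    ; uniform₂  = slice-outside-Uniform zero uniform₂
    ; cross     = λ A∈ B∈ → Intersect-∷⁻ˡ (cross (∈-slice⁻ A∈) (∈-slice⁻ B∈))
    ; nonempty₁ = let (A , A∈) = nonempty₁ in Stable⇒outside₀-nonempty st𝓐 A∈ (subst (λ k → k + k ≤ n) (sym (uniform₁ A∈)) 2l≤n)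
    ; nonempty₂ = let (B , B∈) = nonempty₂ in Stable⇒outside₀-nonempty st𝓑 B∈ (subst (λ k → k + k ≤ n) (sym (uniform₂ B∈)) 2l≤n)
    }

  Stable⇒inside₀-NonemptyCrossIntersecting : ∀ {k} → l ≡ suc k → Stable 𝓑 → k + k < n →
    ∃ (_∈ slice zero inside 𝓐) → ∃ (_∈ slice zero inside 𝓑) →
    NonemptyCrossIntersecting k (slice zero inside 𝓐) (slice zero inside 𝓑)
  Stable⇒inside₀-NonemptyCrossIntersecting refl st𝓑 2k<n A∈ B∈ = record
    { unique₁   = slice-Unique zero inside unique₁
    ; unique₂   = slice-Unique zero inside unique₂
    ; uniform₁  = slice-inside-Uniform zero uniform₁
    ; uniform₂  = slice-inside-Uniform zero uniform₂
    ; cross     = λ A∈ B∈ → Stable⇒inside₀-Intersect st𝓑 cross A∈ B∈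
                    (subst₂ (λ a b → a + b < n) (sym (slice-inside-Uniform zero uniform₁ A∈))
                                                (sym (slice-inside-Uniform zero uniform₂ B∈)) 2k<n)
    ; nonempty₁ = A∈
    ; nonempty₂ = B∈
    }

CrossHiltonMilnerBound : ℕ → ℕ → Set
CrossHiltonMilnerBound n l = ∀ {𝓐 𝓑 : Family n} → NonemptyCrossIntersecting l 𝓐 𝓑 → l + l ≤ n →
                             length 𝓐 + length 𝓑 + (n ∸ l) C l ≤ n C l + 1

crossHiltonMilner-tight : ∀ {l} {𝓐 𝓑 : Family n} → NonemptyCrossIntersecting l 𝓐 𝓑 → l + l ≡ n →
                          length 𝓐 + length 𝓑 + (n ∸ l) C l ≤ n C l + 1
crossHiltonMilner-tight {n} {l} {𝓐} {𝓑} P refl = begin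
  length 𝓐 + length 𝓑 + (l + l ∸ l) C l ≡⟨ cong (λ k → length 𝓐 + length 𝓑 + k C l) (m+n∸n≡m l l) ⟩
  length 𝓐 + length 𝓑 + l C l           ≡⟨ cong (length 𝓐 + length 𝓑 +_) (nCn≡1 l) ⟩
  length 𝓐 + length 𝓑 + 1               ≤⟨ +-monoˡ-≤ 1 complement-bound ⟩
  (l + l) C l + 1                        ∎
  where
  open ≤-Reasoning
  open NonemptyCrossIntersecting P
  complement-bound = crossIntersecting-length≤C 𝓐 𝓑 refl unique₁ unique₂ uniform₁ uniform₂ cross

crossHiltonMilner-absorb : ∀ {m l} → CrossHiltonMilnerBound m l → suc l + suc l ≤ m →
  ∀ {𝓐 𝓑 : Family m} → NonemptyCrossIntersecting l 𝓐 𝓑 → length 𝓐 + length 𝓑 + (m ∸ suc l) C l ≤ m C l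
crossHiltonMilner-absorb {l = zero} _ _ P = ⊥-elim (NonemptyCrossIntersecting⇒l≢0 P refl)
crossHiltonMilner-absorb {m} {suc l} bound 2l<m {𝓐} {𝓑} P =
  pascal-absorb c l l≤c (subst (λ k → length 𝓐 + length 𝓑 + k C suc l ≤ m C suc l + 1) m∸[1+l]≡1+c (bound P 2[1+l]≤m))
  where
  c = m ∸ suc (suc l)
  l≤c : l ≤ c
  l≤c = m+n≤o⇒m≤o∸n l (≤-trans (+-monoˡ-≤ (suc (suc l)) (≤-trans (n≤1+n l) (n≤1+n (suc l)))) 2l<m)
  m∸[1+l]≡1+c : m ∸ suc l ≡ suc c
  m∸[1+l]≡1+c = +-∸-assoc 1 (m+n≤o⇒m≤o (suc (suc l)) 2l<m)
  2[1+l]≤m : suc l + suc l ≤ m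
  2[1+l]≤m = <⇒≤ (<-≤-trans (n+n<[1+n]+[1+n] (suc l)) 2l<m)

-- If one of the two families through 0 is empty, the other one meets a fixed member of the opposite 0-free family.
crossHiltonMilner-inside₀ : ∀ m l → (∀ l → CrossHiltonMilnerBound m l) → suc l + suc l ≤ m →
  ∀ {𝓐 𝓑 : Family (suc m)} → NonemptyCrossIntersecting (suc l) 𝓐 𝓑 → Stable 𝓐 → Stable 𝓑 →
  length (slice zero inside 𝓐) + length (slice zero inside 𝓑) + (m ∸ suc l) C l ≤ m C l
crossHiltonMilner-inside₀ m l ih 2l<m {𝓐} {𝓑} P st𝓐 st𝓑
  with []-or-∈ (slice zero inside 𝓐) | []-or-∈ (slice zero inside 𝓑)
... | inj₁ 𝓐₁≡[] | _ rewrite 𝓐₁≡[] =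
  subst (λ s → length (slice zero inside 𝓑) + (m ∸ s) C l ≤ m C l) (P₀.uniform₁ S∈)
    (meeting-length+C≤C m l S _ (slice-Unique zero inside unique₂) (slice-inside-Uniform zero uniform₂)
      λ B∈ → Intersect-sym (Intersect-∷⁻ˡ (cross (∈-slice⁻ S∈) (∈-slice⁻ B∈))))
  where
  open NonemptyCrossIntersecting P
  module P₀ = NonemptyCrossIntersecting (Stable⇒outside₀-NonemptyCrossIntersecting P st𝓐 st𝓑 2l<m)
  S = proj₁ P₀.nonempty₁
  S∈ = proj₂ P₀.nonempty₁
... | inj₂ _ | inj₁ 𝓑₁≡[] rewrite 𝓑₁≡[] | +-identityʳ (length (slice zero inside 𝓐)) =
  subst (λ s → length (slice zero inside 𝓐) + (m ∸ s) C l ≤ m C l) (P₀.uniform₂ S∈)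
    (meeting-length+C≤C m l S _ (slice-Unique zero inside unique₁) (slice-inside-Uniform zero uniform₁)
      λ A∈ → Intersect-∷⁻ʳ (cross (∈-slice⁻ A∈) (∈-slice⁻ S∈)))
  where
  open NonemptyCrossIntersecting P
  module P₀ = NonemptyCrossIntersecting (Stable⇒outside₀-NonemptyCrossIntersecting P st𝓐 st𝓑 2l<m)
  S = proj₁ P₀.nonempty₂
  S∈ = proj₂ P₀.nonempty₂
... | inj₂ A∈ | inj₂ B∈ =
  crossHiltonMilner-absorb (ih l) 2l<m
    (Stable⇒inside₀-NonemptyCrossIntersecting P refl st𝓑 (<-≤-trans (n+n<[1+n]+[1+n] l) 2l<m) A∈ B∈)

crossHiltonMilner-stable : ∀ m l → (∀ l → CrossHiltonMilnerBound m l) → suc l + suc l ≤ m →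
  ∀ {𝓐 𝓑 : Family (suc m)} → NonemptyCrossIntersecting (suc l) 𝓐 𝓑 → Stable 𝓐 → Stable 𝓑 →
  length 𝓐 + length 𝓑 + (m ∸ l) C suc l ≤ suc m C suc l + 1
crossHiltonMilner-stable m l ih 2l<m {𝓐} {𝓑} P st𝓐 st𝓑 = begin
  length 𝓐 + length 𝓑 + (m ∸ l) C suc l
    ≡⟨ cong₂ _+_ (cong₂ _+_ (length-slices zero 𝓐) (length-slices zero 𝓑)) (cong (_C suc l) (+-∸-assoc 1 l<m)) ⟩
  ((length 𝓐₁ + length 𝓐₀) + (length 𝓑₁ + length 𝓑₀)) + suc (m ∸ suc l) C suc l
    ≡⟨ cong (_+ suc (m ∸ suc l) C suc l) (+-interchange (length 𝓐₁) _ _ _) ⟩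
  ((length 𝓐₁ + length 𝓑₁) + (length 𝓐₀ + length 𝓑₀)) + suc (m ∸ suc l) C suc l
    ≤⟨ pascal-split m (m ∸ suc l) l (crossHiltonMilner-inside₀ m l ih 2l<m P st𝓐 st𝓑)
         (ih (suc l) (Stable⇒outside₀-NonemptyCrossIntersecting P st𝓐 st𝓑 2l<m) 2l<m) ⟩
  suc m C suc l + 1 ∎
  where
  open ≤-Reasoning
  𝓐₁ = slice zero inside 𝓐
  𝓐₀ = slice zero outside 𝓐
  𝓑₁ = slice zero inside 𝓑
  𝓑₀ = slice zero outside 𝓑
  l<m = m+n≤o⇒m≤o (suc l) 2l<m

crossHiltonMilner-shifting : ∀ m l → (∀ l → CrossHiltonMilnerBound m l) → suc l + suc l ≤ m →
  ∀ fuel {𝓐 𝓑 : Family (suc m)} → deg₀ 𝓐 + deg₀ 𝓑 < fuel → NonemptyCrossIntersecting (suc l) 𝓐 𝓑 →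
  length 𝓐 + length 𝓑 + (m ∸ l) C suc l ≤ suc m C suc l + 1
crossHiltonMilner-shifting m l ih 2l<m (suc fuel) {𝓐} {𝓑} deg<fuel P with stable-or-shiftable₂ 𝓐 𝓑
... | inj₁ (st𝓐 , st𝓑)  = crossHiltonMilner-stable m l ih 2l<m P st𝓐 st𝓑
... | inj₂ (j , shift<) =
  subst (λ k → k + (m ∸ l) C suc l ≤ suc m C suc l + 1) (cong₂ _+_ (length-map _ 𝓐) (length-map _ 𝓑))
    (crossHiltonMilner-shifting m l ih 2l<m fuel (<-≤-trans shift< (≤-pred deg<fuel)) (shift-NonemptyCrossIntersecting P j))

crossHiltonMilner : ∀ n l → CrossHiltonMilnerBound n l
crossHiltonMilner n       zero    P _    = ⊥-elim (NonemptyCrossIntersecting⇒l≢0 P refl)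
crossHiltonMilner (suc m) (suc l) P 2l≤n with suc m ≤? suc l + suc l
... | yes n≤2l = crossHiltonMilner-tight P (≤-antisym 2l≤n n≤2l)
... | no  n≰2l = crossHiltonMilner-shifting m l (crossHiltonMilner m) (≤-pred (≰⇒> n≰2l)) _ ≤-refl P

record NontrivialIntersecting (k : ℕ) (𝓕 : Family n) : Set where
  field
    unique       : Unique 𝓕
    uniform      : Uniform k 𝓕
    intersecting : CrossIntersecting 𝓕 𝓕
    nonTrivial   : NonTrivial 𝓕

¬NontrivialIntersecting-singletons : ∀ {𝓕 : Family (suc n)} → ¬ NontrivialIntersecting 1 𝓕
¬NontrivialIntersecting-singletons P = absurd
  where
  open NontrivialIntersecting P
  absurd : ⊥
  absurd with A , A∈ , _    ← nonTrivial zero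
         with i , A∋i , _   ← intersecting A∈ A∈
         with B , B∈ , B∌i  ← nonTrivial i
         with j , A∋j , B∋j ← intersecting A∈ B∈
         with refl          ← ∣∣≡1⇒inside-unique A (uniform A∈) A∋i A∋j
         with ()            ← trans (sym B∋j) B∌i

-- With n = m + 1 and d = k + 1 this reads |𝓕| + C(n−d−1, d−1) ≤ C(n−1, d−1) + 1.
HiltonMilnerBound : ℕ → ℕ → Set
HiltonMilnerBound m k = ∀ {𝓕 : Family (suc m)} → NontrivialIntersecting (suc k) 𝓕 → suc k + suc k ≤ suc m →
                        length 𝓕 + (m ∸ suc k) C k ≤ m C k + 1

hiltonMilner-tight : ∀ {m k} {𝓕 : Family (suc m)} → NontrivialIntersecting (suc k) 𝓕 → suc k + suc k ≡ suc m →
                     length 𝓕 + (m ∸ suc k) C k ≤ m C k + 1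
hiltonMilner-tight {k = k} {𝓕} P refl = begin
  length 𝓕 + (k + suc k ∸ suc k) C k ≡⟨ cong (λ a → length 𝓕 + a C k) (m+n∸n≡m k (suc k)) ⟩
  length 𝓕 + k C k                   ≡⟨ cong (length 𝓕 +_) (nCn≡1 k) ⟩
  length 𝓕 + 1                       ≤⟨ +-monoˡ-≤ 1 (m+m≤n+n⇒m≤n 2∣𝓕∣≤2C) ⟩
  m C k + 1                          ∎
  where
  open ≤-Reasoning
  open NontrivialIntersecting P
  m = k + suc k
  2∣𝓕∣≤2C : length 𝓕 + length 𝓕 ≤ m C k + m C k
  2∣𝓕∣≤2C = begin
    length 𝓕 + length 𝓕 ≤⟨ crossIntersecting-length≤C 𝓕 𝓕 refl unique unique uniform uniform intersecting ⟩
    suc m C suc k       ≡⟨ nCk+nC[k+1]≡[n+1]C[k+1] m k ⟨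
    m C k + m C suc k   ≡⟨ cong (m C k +_) (trans (nCk≡nC[n∸k] (m≤n+m (suc k) k)) (cong (m C_) (m+n∸n≡m k (suc k)))) ⟩
    m C k + m C k       ∎

CoveredBy : Family (suc n) → Fin (suc n) → Fin (suc n) → Set
CoveredBy 𝓕 i j = ∀ {A} → A ∈ 𝓕 → lookup A i ≡ inside ⊎ lookup A j ≡ inside

module _ {m k} j {𝓕 : Family (suc (suc m))} (P : NontrivialIntersecting (suc (suc k)) 𝓕) (covered : CoveredBy 𝓕 zero (suc j)) where
  open NontrivialIntersecting P

  private
    𝓕₀∋j : ∀ {A} → A ∈ slice zero outside 𝓕 → lookup A j ≡ inside
    𝓕₀∋j A∈ with inj₂ A∋j ← covered (∈-slice⁻ A∈) = A∋j

  coveredBy-length : length 𝓕 ≡ length (slice j inside (slice zero inside 𝓕)) +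
                                 (length (slice j inside (slice zero outside 𝓕)) + length (slice j outside (slice zero inside 𝓕)))
  coveredBy-length = begin
    length 𝓕                                   ≡⟨ length-slices zero 𝓕 ⟩
    length 𝓕₁ + length 𝓕₀                      ≡⟨ cong₂ _+_ (length-slices j 𝓕₁) (sym (length-slice-all j inside 𝓕₀∋j)) ⟩
    (length 𝓩 + length 𝓨) + length 𝓧           ≡⟨ +-assoc (length 𝓩) _ _ ⟩
    length 𝓩 + (length 𝓨 + length 𝓧)           ≡⟨ cong (length 𝓩 +_) (+-comm (length 𝓨) _) ⟩
    length 𝓩 + (length 𝓧 + length 𝓨)           ∎
    where
    open ≡-Reasoning
    𝓕₀ = slice zero outside 𝓕
    𝓕₁ = slice zero inside 𝓕
    𝓧 = slice j inside 𝓕₀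
    𝓨 = slice j outside 𝓕₁
    𝓩 = slice j inside 𝓕₁

  coveredBy-NonemptyCrossIntersecting :
    NonemptyCrossIntersecting (suc k) (slice j inside (slice zero outside 𝓕)) (slice j outside (slice zero inside 𝓕))
  coveredBy-NonemptyCrossIntersecting = record
    { unique₁   = slice-Unique j inside (slice-Unique zero outside unique)
    ; unique₂   = slice-Unique j outside (slice-Unique zero inside unique)
    ; uniform₁  = slice-inside-Uniform j (slice-outside-Uniform zero uniform)
    ; uniform₂  = slice-outside-Uniform j (slice-inside-Uniform zero uniform)
    ; cross     = λ A∈ B∈ → Intersect-sym (Intersect-insertAt-outside j
                    (Intersect-sym (Intersect-∷⁻ˡ (intersecting (∈-slice⁻ (∈-slice⁻ A∈)) (∈-slice⁻ (∈-slice⁻ B∈))))))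
    ; nonempty₁ = member-avoiding-0 (nonTrivial zero)
    ; nonempty₂ = member-avoiding-j+1 (nonTrivial (suc j))
    }
    where
    member-avoiding-0 : Σ _ (λ A → A ∈ 𝓕 × lookup A zero ≡ outside) → ∃ (_∈ slice j inside (slice zero outside 𝓕))
    member-avoiding-0 (outside ∷ A , A∈ , _) = removeAt A j , ∈-slice⁺ (∈-slice⁺ A∈ refl) (𝓕₀∋j (∈-slice⁺ A∈ refl))
    member-avoiding-j+1 : Σ _ (λ A → A ∈ 𝓕 × lookup A (suc j) ≡ outside) → ∃ (_∈ slice j outside (slice zero inside 𝓕))
    member-avoiding-j+1 (x ∷ A , A∈ , A∌j) with covered A∈
    ... | inj₁ refl = removeAt A j , ∈-slice⁺ (∈-slice⁺ A∈ refl) A∌j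
    ... | inj₂ A∋j with () ← trans (sym A∋j) A∌j

hiltonMilner-coveredByTwo : ∀ m k j → suc k + suc k ≤ m → ∀ {𝓕 : Family (suc (suc m))} →
  NontrivialIntersecting (suc (suc k)) 𝓕 → CoveredBy 𝓕 zero (suc j) →
  length 𝓕 + (m ∸ suc k) C suc k ≤ suc m C suc k + 1
hiltonMilner-coveredByTwo m k j 2k<m {𝓕} P covered = begin
  length 𝓕 + c C suc k                              ≡⟨ cong (_+ c C suc k) (coveredBy-length j P covered) ⟩
  (length 𝓩 + (length 𝓧 + length 𝓨)) + c C suc k    ≡⟨ +-assoc (length 𝓩) _ _ ⟩
  length 𝓩 + ((length 𝓧 + length 𝓨) + c C suc k)    ≤⟨ +-mono-≤ 𝓩-bound 𝓧𝓨-bound ⟩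
  m C k + (m C suc k + 1)                           ≡⟨ +-assoc (m C k) _ 1 ⟨
  (m C k + m C suc k) + 1                           ≡⟨ cong (_+ 1) (nCk+nC[k+1]≡[n+1]C[k+1] m k) ⟩
  suc m C suc k + 1                                 ∎
  where
  open ≤-Reasoning
  open NontrivialIntersecting P
  c = m ∸ suc k
  𝓧 = slice j inside (slice zero outside 𝓕)
  𝓨 = slice j outside (slice zero inside 𝓕)
  𝓩 = slice j inside (slice zero inside 𝓕)
  𝓩-bound : length 𝓩 ≤ m C k
  𝓩-bound = length≤C m k 𝓩 (slice-Unique j inside (slice-Unique zero inside unique))
              (slice-inside-Uniform j (slice-inside-Uniform zero uniform))
  𝓧𝓨-bound : length 𝓧 + length 𝓨 + c C suc k ≤ m C suc k + 1
  𝓧𝓨-bound = crossHiltonMilner m (suc k) (coveredBy-NonemptyCrossIntersecting j P covered) 2k<m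

hiltonMilner-absorb : ∀ {m k} → HiltonMilnerBound m k → suc (suc k) + suc (suc k) ≤ suc m →
  ∀ {𝓕 : Family (suc m)} → NontrivialIntersecting (suc k) 𝓕 → length 𝓕 + (m ∸ suc (suc k)) C k ≤ m C k
hiltonMilner-absorb {k = zero}  _ _ P = ⊥-elim (¬NontrivialIntersecting-singletons P)
hiltonMilner-absorb {m} {suc k} bound 2k<n {𝓕} P =
  pascal-absorb (m ∸ suc (suc (suc k))) k k≤c
    (subst (λ a → length 𝓕 + a C suc k ≤ m C suc k + 1) (+-∸-assoc 1 k+3≤m)
      (bound P (≤-trans (+-mono-≤ (n≤1+n (suc (suc k))) (n≤1+n (suc (suc k)))) 2k<n)))
  where
  k+3≤m : suc (suc (suc k)) ≤ m
  k+3≤m = m+n≤o⇒n≤o (suc (suc k)) (≤-pred 2k<n)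
  k≤c : k ≤ m ∸ suc (suc (suc k))
  k≤c = m+n≤o⇒m≤o∸n k (≤-trans (+-monoˡ-≤ (suc (suc (suc k))) (≤-trans (n≤1+n k) (n≤1+n (suc k)))) (≤-pred 2k<n))

hiltonMilner-inside₀ : ∀ m k → (∀ k → HiltonMilnerBound m k) → suc (suc k) + suc (suc k) ≤ suc m →
  ∀ {𝓕 : Family (suc (suc m))} → NontrivialIntersecting (suc (suc k)) 𝓕 → Stable 𝓕 → NonTrivial (slice zero outside 𝓕) →
  length (slice zero inside 𝓕) + (m ∸ suc (suc k)) C k ≤ m C k
hiltonMilner-inside₀ m k ih 2k<n {𝓕} P st nt₀ with nonTrivial-or-common (slice zero inside 𝓕)
... | inj₁ nt₁ = hiltonMilner-absorb (ih k) 2k<n record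
  { unique       = slice-Unique zero inside unique
  ; uniform      = slice-inside-Uniform zero uniform
  ; intersecting = λ A∈ B∈ → Stable⇒inside₀-Intersect st intersecting A∈ B∈
                     (subst₂ (λ a b → a + b < suc m) (sym (slice-inside-Uniform zero uniform A∈)) (sym (slice-inside-Uniform zero uniform B∈))
                       (<-≤-trans (n+n<[1+n]+[1+n] (suc k)) 2k<n))
  ; nonTrivial   = nt₁
  }
  where open NontrivialIntersecting P
... | inj₂ (i , common) with B , B∈ , B∌i ← nt₀ i =
  subst₂ (λ a b → a + (m ∸ b) C k ≤ m C k) (length-slice-all i inside common)
    (trans (∣removeAt-outside∣ B i B∌i) (slice-outside-Uniform zero uniform B∈))
    (meeting-length+C≤C m k (removeAt B i) (slice i inside (slice zero inside 𝓕))
      (slice-Unique i inside (slice-Unique zero inside unique)) (slice-inside-Uniform i (slice-inside-Uniform zero uniform))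
      λ A∈ → Intersect-removeAt i B∌i (Intersect-∷⁻ʳ (intersecting (∈-slice⁻ (∈-slice⁻ A∈)) (∈-slice⁻ B∈))))
  where open NontrivialIntersecting P

hiltonMilner-stable : ∀ m k → (∀ k → HiltonMilnerBound m k) → suc (suc k) + suc (suc k) ≤ suc m →
  ∀ {𝓕 : Family (suc (suc m))} → NontrivialIntersecting (suc (suc k)) 𝓕 → Stable 𝓕 →
  length 𝓕 + (m ∸ suc k) C suc k ≤ suc m C suc k + 1
hiltonMilner-stable m k ih 2k<n {𝓕} P st with nonTrivial-or-common (slice zero outside 𝓕)
... | inj₂ (i , common) = hiltonMilner-coveredByTwo m k i (≤-pred (<-≤-trans (n+n<[1+n]+[1+n] (suc k)) 2k<n)) P covered
  where
  covered : CoveredBy 𝓕 zero (suc i)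
  covered {inside  ∷ A} _  = inj₁ refl
  covered {outside ∷ A} A∈ = inj₂ (common (∈-slice⁺ A∈ refl))
... | inj₁ nt₀ = begin
  length 𝓕 + (m ∸ suc k) C suc k                                   ≡⟨ cong₂ _+_ (length-slices zero 𝓕) (cong (_C suc k) (+-∸-assoc 1 k+2≤m)) ⟩
  (length 𝓕₁ + length 𝓕₀) + suc (m ∸ suc (suc k)) C suc k          ≤⟨ pascal-split m (m ∸ suc (suc k)) k
                                                                         (hiltonMilner-inside₀ m k ih 2k<n P st nt₀) (ih (suc k) P₀ 2k<n) ⟩
  suc m C suc k + 1                                                 ∎
  where
  open ≤-Reasoning
  open NontrivialIntersecting P
  k+2≤m = m+n≤o⇒n≤o (suc k) (≤-pred 2k<n)
  𝓕₀ = slice zero outside 𝓕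
  𝓕₁ = slice zero inside 𝓕
  P₀ : NontrivialIntersecting (suc (suc k)) 𝓕₀
  P₀ = record
    { unique       = slice-Unique zero outside unique
    ; uniform      = slice-outside-Uniform zero uniform
    ; intersecting = λ A∈ B∈ → Intersect-∷⁻ˡ (intersecting (∈-slice⁻ A∈) (∈-slice⁻ B∈))
    ; nonTrivial   = nt₀
    }

-- Shifting keeps 𝓕 nontrivial if some member avoids both 0 and j + 1; otherwise {0, j + 1} covers 𝓕.
hiltonMilner-shifting : ∀ m k → (∀ k → HiltonMilnerBound m k) → suc (suc k) + suc (suc k) ≤ suc m →
  ∀ fuel {𝓕 : Family (suc (suc m))} → deg₀ 𝓕 < fuel → NontrivialIntersecting (suc (suc k)) 𝓕 →
  length 𝓕 + (m ∸ suc k) C suc k ≤ suc m C suc k + 1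
hiltonMilner-shifting m k ih 2k<n (suc fuel) {𝓕} deg<fuel P with stable-or-shiftable 𝓕
... | inj₁ st = hiltonMilner-stable m k ih 2k<n P st
... | inj₂ (j , shift<) with Any.any? (λ A → side? zero outside A ×-dec side? (suc j) outside A) 𝓕
... | no ¬avoiding = hiltonMilner-coveredByTwo m k j (≤-pred (<-≤-trans (n+n<[1+n]+[1+n] (suc k)) 2k<n)) P covered
  where
  covered : CoveredBy 𝓕 zero (suc j)
  covered {A} A∈ with lookup A zero in A[0] | lookup A (suc j) in A[j+1]
  ... | inside  | _       = inj₁ refl
  ... | outside | inside  = inj₂ refl
  ... | outside | outside = ⊥-elim (¬avoiding (lose A∈ (A[0] , A[j+1])))
... | yes avoiding with find avoiding
... | outside ∷ B , B∈ , (refl , B∌j) =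
  subst (λ a → a + (m ∸ suc k) C suc k ≤ suc m C suc k + 1) (length-map _ 𝓕)
    (hiltonMilner-shifting m k ih 2k<n fuel (<-≤-trans shift< (≤-pred deg<fuel)) record
      { unique       = shift-Unique j unique
      ; uniform      = shift-Uniform j uniform
      ; intersecting = shift-CrossIntersecting j intersecting
      ; nonTrivial   = shift-NonTrivial j nonTrivial B∈ B∌j
      })
  where open NontrivialIntersecting P

hiltonMilner : ∀ m k → HiltonMilnerBound m k
hiltonMilner m       zero    P _    = ⊥-elim (¬NontrivialIntersecting-singletons P)
hiltonMilner zero    (suc k) P (s≤s ())
hiltonMilner (suc m) (suc k) P 2k≤n with suc (suc m) ≤? suc (suc k) + suc (suc k)
... | yes n≤2k = hiltonMilner-tight P (≤-antisym 2k≤n n≤2k)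
... | no  n≰2k = hiltonMilner-shifting m k (hiltonMilner m) (≤-pred (≰⇒> n≰2k)) _ ≤-refl P

hiltonMilner-length≤ : ∀ n d {𝓕 : Family n} → NontrivialIntersecting d 𝓕 → d + d ≤ n →
                       length 𝓕 ≤ (n ∸ 1) C (d ∸ 1) ∸ (n ∸ d ∸ 1) C (d ∸ 1) + 1
hiltonMilner-length≤ n zero {[]} _ _ = z≤n
hiltonMilner-length≤ n zero {A ∷ _} P _ =
  ⊥-elim (∣∣≡0⇒¬Intersect A (uniform (here refl)) (intersecting (here refl) (here refl)))
  where open NontrivialIntersecting P
hiltonMilner-length≤ (suc m) (suc k) {𝓕} P 2d≤n =
  m+n≤o+1⇒m≤o∸n+1 (length 𝓕) _ (m C k)
    (subst (λ a → length 𝓕 + a C k ≤ m C k + 1) m∸[1+k]≡m∸k∸1 (hiltonMilner m k P 2d≤n))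
  where
  m∸[1+k]≡m∸k∸1 : m ∸ suc k ≡ m ∸ k ∸ 1
  m∸[1+k]≡m∸k∸1 = trans (cong (m ∸_) (+-comm 1 k)) (sym (∸-+-assoc m k 1))

-- Codes

module _ {c ℓ q} (F : FiniteField c ℓ q) where
  open FiniteField F using (_≈_; 0#; enum) renaming (_≟_ to _≈?_)
  private
    module 𝔽 = FiniteField F
    open Inverse enum using (from)

  σ : Word F n → Subset n
  σ x = indicator (λ i → ¬? (x i ≈? 0#))

  Δ : Word F n → Word F n → Subset n
  Δ x y = indicator (λ i → ¬? (x i ≈? y i))

  σ-inside : ∀ (x : Word F n) {i} → ¬ x i ≈ 0# → lookup (σ x) i ≡ inside
  σ-inside x = indicator-inside (λ i → ¬? (x i ≈? 0#))

  σ-inside⁻ : ∀ (x : Word F n) {i} → lookup (σ x) i ≡ inside → ¬ x i ≈ 0#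
  σ-inside⁻ x = indicator-inside⁻ (λ i → ¬? (x i ≈? 0#))

  σ-outside : ∀ (x : Word F n) {i} → x i ≈ 0# → lookup (σ x) i ≡ outside
  σ-outside x x[i]≈0 = indicator-outside (λ i → ¬? (x i ≈? 0#)) λ x[i]≉0 → x[i]≉0 x[i]≈0

  Δ-inside : ∀ (x y : Word F n) {i} → ¬ x i ≈ y i → lookup (Δ x y) i ≡ inside
  Δ-inside x y = indicator-inside (λ i → ¬? (x i ≈? y i))

  Δ-inside⁻ : ∀ (x y : Word F n) {i} → lookup (Δ x y) i ≡ inside → ¬ x i ≈ y i
  Δ-inside⁻ x y = indicator-inside⁻ (λ i → ¬? (x i ≈? y i))

  weight≡∣σ∣ : ∀ (x : Word F n) → weight F x ≡ ∣ σ x ∣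
  weight≡∣σ∣ x = length-filter-allFin (λ i → ¬? (x i ≈? 0#))

  dist≡∣Δ∣ : ∀ (x y : Word F n) → dist F x y ≡ ∣ Δ x y ∣
  dist≡∣Δ∣ x y = length-filter-allFin (λ i → ¬? (x i ≈? y i))

  from-injective : ∀ {a b} → from a ≡ from b → a ≈ b
  from-injective = Injection.injective (Inverse⇒Injection (↔-sym enum))

  MinDistance⇒≢0 : ∀ {p} {𝒞 : Code F n p} {d} → MinDistance F 𝒞 d → d ≢ 0
  MinDistance⇒≢0 ((x , y , _ , _ , x≉y , dist≡d) , _) refl = x≉y λ i →
    decidable-stable (x i ≈? y i) λ x[i]≉y[i] →
      inside⇒∣∣≢0 (Δ x y) (Δ-inside x y x[i]≉y[i]) (trans (sym (dist≡∣Δ∣ x y)) dist≡d)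

  -- Δ x y ⊂ σ x: outside σ x = σ y both words vanish, and i lies in σ x but not in Δ x y.
  dist<weight : ∀ {x y : Word F n} {i} → σ x ≡ σ y → lookup (σ x) i ≡ inside → x i ≈ y i → dist F x y < weight F x
  dist<weight {x = x} {y} {i} σx≡σy σx∋i x[i]≈y[i] =
    subst₂ _<_ (sym (dist≡∣Δ∣ x y)) (sym (weight≡∣σ∣ x))
      (p⊂q⇒∣p∣<∣q∣ (Δ⊆σ , i , lookup⇒[]= i (σ x) σx∋i , λ i∈Δ → Δ-inside⁻ x y ([]=⇒lookup i∈Δ) x[i]≈y[i]))
    where
    Δ⊆σ : Δ x y Subset.⊆ σ x
    Δ⊆σ {k} k∈Δ = lookup⇒[]= k (σ x) (σ-inside x x[k]≉0)
      where
      x[k]≉0 : ¬ x k ≈ 0#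
      x[k]≉0 x[k]≈0 = Δ-inside⁻ x y ([]=⇒lookup k∈Δ) (𝔽.trans x[k]≈0 (𝔽.sym y[k]≈0))
        where
        y[k]≈0 = decidable-stable (y k ≈? 0#) λ y[k]≉0 →
          σ-inside⁻ x (subst (λ S → lookup S k ≡ inside) (sym σx≡σy) (σ-inside y y[k]≉0)) x[k]≈0

  leading : Word F n → Fin q
  leading x = maybe′ (λ i → from (x i)) (from 0#) (pivot (σ x))

  leading-pivot : ∀ (x : Word F n) {S i} → σ x ≡ S → pivot S ≡ just i → leading x ≡ from (x i)
  leading-pivot x refl e = cong (maybe′ (λ i → from (x i)) (from 0#)) e

  profile : Word F n → Subset n × Fin q
  profile x = σ x , leading x

  pivot-σ : ∀ (x : Word F n) → weight F x ≢ 0 → Σ (Fin n) λ j → pivot (σ x) ≡ just j × lookup (σ x) j ≡ inside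
  pivot-σ x wx≢0 = let (i , σx∋i) = ∣∣≢0⇒inside (σ x) (wx≢0 ∘ trans (weight≡∣σ∣ x)) in pivot-inside (σ x) σx∋i

  -- Two codewords with the same profile agree at the pivot of their common support.
  profile-injective : ∀ {p} {𝒞 : Code F n p} {d} → MinDistance F 𝒞 d → ∀ {x y} → 𝒞 x → 𝒞 y →
                      weight F x ≡ d → ¬ _≈W_ F x y → profile x ≢ profile y
  profile-injective md {x} {y} x∈ y∈ wx≡d x≉y e
    with j , pivot≡j , σx∋j ← pivot-σ x (MinDistance⇒≢0 md ∘ trans (sym wx≡d)) =
    <⇒≱ (dist<weight σx≡σy σx∋j (from-injective from[x[j]]≡from[y[j]]))
        (subst (_≤ dist F x y) (sym wx≡d) (proj₂ md x y x∈ y∈ x≉y))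
    where
    σx≡σy = cong proj₁ e
    from[x[j]]≡from[y[j]] : from (x j) ≡ from (y j)
    from[x[j]]≡from[y[j]] = trans (sym (leading-pivot x refl pivot≡j)) (trans (cong proj₂ e) (leading-pivot y (sym σx≡σy) pivot≡j))

  nonzeroSymbols : List (Fin q)
  nonzeroSymbols = filter (λ a → ¬? (a Fin.≟ from 0#)) (allFin q)

  length-nonzeroSymbols : length nonzeroSymbols ≤ q ∸ 1
  length-nonzeroSymbols = m+n≤o⇒m≤o∸n _ (subst (_≤ q) (+-comm 1 _) (subst (length nonzeroSymbols <_) (length-tabulate id)
    (filter-notAll (λ a → ¬? (a Fin.≟ from 0#)) (allFin q) (lose (∈-allFin (from 0#)) λ ≢ → ≢ refl))))

  leading∈nonzeroSymbols : ∀ (x : Word F n) → weight F x ≢ 0 → leading x ∈ nonzeroSymbols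
  leading∈nonzeroSymbols x wx≢0 with j , pivot≡j , σx∋j ← pivot-σ x wx≢0 =
    subst (_∈ nonzeroSymbols) (sym (leading-pivot x refl pivot≡j))
      (∈-filter⁺ (λ a → ¬? (a Fin.≟ from 0#)) (∈-allFin (from (x j))) (σ-inside⁻ x σx∋j ∘ from-injective))

  length≤[q∸1]*length : ∀ {p} {𝒞 : Code F n p} {d} → MinDistance F 𝒞 d → ∀ {xs} →
    All (λ x → 𝒞 x × weight F x ≡ d) xs → AllPairs (λ x y → ¬ _≈W_ F x y) xs →
    ∀ {𝒮} → (∀ {x} → x ∈ xs → σ x ∈ 𝒮) → length xs ≤ (q ∸ 1) * length 𝒮
  length≤[q∸1]*length md {xs} codewords distinct {𝒮} σ∈𝒮 = begin
    length xs                                   ≡⟨ length-map profile xs ⟨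
    length (map profile xs)                     ≤⟨ Unique-⊆⇒length≤ profiles-distinct profiles⊆ ⟩
    length (cartesianProduct 𝒮 nonzeroSymbols)  ≡⟨ length-cartesianProduct 𝒮 nonzeroSymbols ⟩
    length 𝒮 * length nonzeroSymbols            ≤⟨ *-monoʳ-≤ (length 𝒮) length-nonzeroSymbols ⟩
    length 𝒮 * (q ∸ 1)                          ≡⟨ *-comm (length 𝒮) (q ∸ 1) ⟩
    (q ∸ 1) * length 𝒮                          ∎
    where
    open ≤-Reasoning
    profiles-distinct : Unique (map profile xs)
    profiles-distinct = Unique-map profile codewords distinct λ (x∈ , wx≡d) (y∈ , _) → profile-injective md x∈ y∈ wx≡d
    profiles⊆ : map profile xs ⊆ cartesianProduct 𝒮 nonzeroSymbols
    profiles⊆ z∈ with x , x∈xs , refl ← ∈-map⁻ profile z∈ =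
      ∈-cartesianProduct⁺ (σ∈𝒮 x∈xs)
        (leading∈nonzeroSymbols x (MinDistance⇒≢0 md ∘ trans (sym (proj₂ (All.lookup codewords x∈xs)))))

  supports-NontrivialIntersecting : ∀ {p} {𝒞 : Code F n p} {d} → Intersecting F 𝒞 → d ≢ 0 → ∀ {ws} →
    All (λ w → 𝒞 w × weight F w ≡ d) ws → (∀ j → Σ (Word F n) λ w → w ∈ ws × w j ≈ 0#) →
    NontrivialIntersecting d (deduplicate _≟ₛ_ (map σ ws))
  supports-NontrivialIntersecting {n = n} {𝒞 = 𝒞} {d} intersecting d≢0 {ws} codewords avoiding = record
    { unique       = deduplicate-! _≟ₛ_ (map σ ws)
    ; uniform      = λ S∈ → let (w , w∈ , S≡σw) = member S∈ in trans (cong ∣_∣ S≡σw) (trans (sym (weight≡∣σ∣ w)) (has-weight w∈))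
    ; intersecting = λ S∈ T∈ → let (v , v∈ , S≡σv) = member S∈ ; (w , w∈ , T≡σw) = member T∈
                                   (i , v[i]≉0 , w[i]≉0) = intersecting v w (code v∈) (code w∈) (nonzero v v∈) (nonzero w w∈) in
                               subst₂ Intersect (sym S≡σv) (sym T≡σw) (i , σ-inside v v[i]≉0 , σ-inside w w[i]≉0)
    ; nonTrivial   = λ j → let (w , w∈ , w[j]≈0) = avoiding j in
                       σ w , ∈-deduplicate⁺ _≟ₛ_ (∈-map⁺ σ w∈) , σ-outside w w[j]≈0
    }
    where
    member : ∀ {S} → S ∈ deduplicate _≟ₛ_ (map σ ws) → Σ (Word F n) λ w → w ∈ ws × S ≡ σ w
    member S∈ = ∈-map⁻ σ (∈-deduplicate⁻ _≟ₛ_ (map σ ws) S∈)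
    code : ∀ {w} → w ∈ ws → 𝒞 w
    code = proj₁ ∘ All.lookup codewords
    has-weight : ∀ {w} → w ∈ ws → weight F w ≡ d
    has-weight = proj₂ ∘ All.lookup codewords
    nonzero : ∀ w → w ∈ ws → NonZero F w
    nonzero w w∈ all-zero = let (i , σw∋i) = ∣∣≢0⇒inside (σ w) (d≢0 ∘ trans (sym (has-weight w∈)) ∘ trans (weight≡∣σ∣ w)) in
                            σ-inside⁻ w σw∋i (all-zero i)

corollary3p13 : ∀ {c ℓ p : Level} {q : ℕ} (F : FiniteField c ℓ q) (n d : ℕ)
    (𝒞 : Code F n p) →
    IsLinear F 𝒞 →
    Intersecting F 𝒞 →
    MinDistance F 𝒞 d →
    2 * d ≤ n →
    ¬ (Σ (Fin n) λ j → ∀ x → 𝒞 x → weight F x ≡ d →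
         ¬ (FiniteField._≈_ F (x j) (FiniteField.0# F))) →
    W≤ F 𝒞 d ((q ∸ 1) * (((n ∸ 1) C (d ∸ 1)) ∸ ((n ∸ d ∸ 1) C (d ∸ 1)) + 1))
corollary3p13 {q = q} F n d 𝒞 _ intersecting minDistance 2d≤n no-common-coordinate xs codewords distinct =
  decidable-stable (length xs ≤? _) (¬¬-map bound (¬¬-∀-Fin avoiding))
  where
  open FiniteField F using (_≈_; 0#)
  -- The last hypothesis only yields doubly negated witnesses; the goal is decidable, so they suffice.
  Avoiding : Fin n → Set _
  Avoiding j = Σ (Word F n) λ w → (𝒞 w × weight F w ≡ d) × w j ≈ 0#
  avoiding : ∀ j → ¬ ¬ Avoiding j
  avoiding j ¬avoiding = no-common-coordinate (j , λ w w∈𝒞 w-weight w[j]≈0 → ¬avoiding (w , (w∈𝒞 , w-weight) , w[j]≈0))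
  bound : (∀ j → Avoiding j) → length xs ≤ (q ∸ 1) * (((n ∸ 1) C (d ∸ 1)) ∸ ((n ∸ d ∸ 1) C (d ∸ 1)) + 1)
  bound witness = begin
    length xs           ≤⟨ length≤[q∸1]*length F minDistance codewords distinct (∈-deduplicate⁺ _ ∘ ∈-map⁺ (σ F) ∘ ∈-++⁺ˡ) ⟩
    (q ∸ 1) * length 𝒮  ≤⟨ *-monoʳ-≤ (q ∸ 1) (hiltonMilner-length≤ n d supports (subst (_≤ n) (cong (d +_) (+-identityʳ d)) 2d≤n)) ⟩
    (q ∸ 1) * (((n ∸ 1) C (d ∸ 1)) ∸ ((n ∸ d ∸ 1) C (d ∸ 1)) + 1) ∎
    where
    open ≤-Reasoning
    ws = xs ++ List.tabulate (proj₁ ∘ witness)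
    𝒮 = deduplicate _≟ₛ_ (map (σ F) ws)
    supports : NontrivialIntersecting d 𝒮
    supports = supports-NontrivialIntersecting F intersecting (MinDistance⇒≢0 F minDistance)
      (All.++⁺ codewords (All.tabulate⁺ (proj₁ ∘ proj₂ ∘ witness)))
      (λ j → proj₁ (witness j) , ∈-++⁺ʳ xs (∈-tabulate⁺ j) , proj₂ (proj₂ (witness j)))
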